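{- Let $q$ be a prime power and $f_1,\dots,f_m\in\mathbb{Z}[x_1,\dots,x_n]$ homogeneous; write $\mathbf f=(f_1,\dots,f_m)$. (1) $\bar N(f_1f_2,f_3,\dots,f_m)=\bar N(f_1,f_3,\dots,f_m)+\bar N(f_2,f_3,\dots,f_m)-\bar N(f_1,f_2,f_3,\dots,f_m)$, all counted in $\mathbb{P}\mathbb{F}_q^{n-1}$. (2) Suppose $f_1=g_1x_1-g_0$ with $g_1,g_0\in\mathbb{Z}[x_2,\dots,x_n]$. For $j=2,\dots,m$ write $f_j=h_{j,k_j}x_1^{k_j}+\dots+h_{j,0}$ with $h_{j,i}\in\mathbb{Z}[x_2,\dots,x_n]$, set $\bar f_j=\sum_{i=0}^{k_j}h_{j,i}\,g_0^{i}g_1^{k_j-i}$, and set $\hat f_j=h_{j,k_j}g_0$ if $k_j>0$ and $\hat f_j=h_{j,0}$ if $k_j=0$. Then $$\bar N(\mathbf f)=\bar N(g_1,g_0,f_2,\dots,f_m)_{\mathbb{P}\mathbb{F}_q^{n-1}}+\bar N(\bar f_2,\dots,\bar f_m)_{\mathbb{P}\mathbb{F}_q^{n-2}}-\bar N(g_1,\hat f_2,\dots,\hat f_m)_{\mathbb{P}\mathbb{F}_q^{n-2}},$$ where the last two counts are in the variables $x_2,\dots,x_n$ (and $\bar N$ of an empty list is $0$). (3) Let $I\subset\{1,\dots,n\}$ and $g,h\in\mathbb{Z}[(x_j)_{j\notin I}]$. Suppose the substitution $x_i\mapsto x_ig/h$ for $i\in I$ transforms $\mathbf f$ into $\tilde{\mathbf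 f}\,g^k/h^\ell$ for (possibly non-homogeneous) polynomials $\tilde{\mathbf f}=(\tilde f_1,\dots,\tilde f_m)$ and integers $k,\ell$. Then, counting in affine space $\mathbb{F}_q^n$, $$\bar N(\mathbf f)_{\mathbb{F}_q^n}=\bar N(gh,\mathbf f)_{\mathbb{F}_q^n}+\bar N(\tilde{\mathbf f})_{\mathbb{F}_q^n}-\bar N(gh,\tilde{\mathbf f})_{\mathbb{F}_q^n}.$$
   Context: For homogeneous $f_1,\dots,f_m$ in variables $y_1,\dots,y_N$, $\bar N(f_1,\dots,f_m)_{\mathbb{P}\mathbb{F}_q^{N-1}}$ is the number of points of $\mathbb{P}^{N-1}(\mathbb{F}_q)$ at which at least one $f_i$ is nonzero. For arbitrary polynomials, $\bar N(f_1,\dots,f_m)_{\mathbb{F}_q^N}$ is the number of points of $\mathbb{F}_q^N$ at which at least one $f_i$ is nonzero. $\mathbb{P}\mathbb{F}_q^{n-1}$ denotes projective space on $x_1,\dots,x_n$. -}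

module Defs where

open import Level using (0ℓ)
open import Data.Nat as ℕ using (ℕ; zero; suc; _∸_)
open import Data.Integer as ℤ using (ℤ; +_; -[1+_])
open import Data.Fin as Fin using (Fin; zero; suc; toℕ; fromℕ)
open import Data.Fin.Subset using (Subset; Side; inside; outside)
open import Data.Bool using (Bool; true; false; not; if_then_else_)
open import Data.List as List using (List; []; _∷_; length; filter; allFin; concatMap)
open import Data.Bool.ListAction using (any)
open import Data.Vec as Vec using (Vec; []; _∷_; lookup)
open import Data.Product using (∃; _×_; _,_)
open import Relation.Nullary using (does; ¬_)
open import Relation.Binary.PropositionalEquality using (_≡_; _≢_)
open import Algebra.Core using (Op₁; Op₂)
open import Algebra.Structures using (IsCommutativeRing)
open import Algebra.Bundles using (CommutativeRing)

-- Polynomials with integer coefficients in variables x_0 .. x_{n-1}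
-- (the paper's x_1 .. x_n), as formal expressions.

infixl 6 _⊕_ _⊝_
infixl 7 _⊗_
infix 8 ⊖_

data Poly (n : ℕ) : Set where
  con  : ℤ → Poly n
  var  : Fin n → Poly n
  _⊕_  : Poly n → Poly n → Poly n
  _⊗_  : Poly n → Poly n → Poly n
  ⊖_   : Poly n → Poly n

_⊝_ : ∀ {n} → Poly n → Poly n → Poly n
p ⊝ q = p ⊕ (⊖ q)

_^ᵖ_ : ∀ {n} → Poly n → ℕ → Poly n
p ^ᵖ zero  = con (+ 1)
p ^ᵖ suc k = p ⊗ (p ^ᵖ k)

∑ᵖ : ∀ {n k} → (Fin k → Poly n) → Poly n
∑ᵖ {k = zero}  f = con (+ 0)
∑ᵖ {k = suc k} f = f zero ⊕ ∑ᵖ (λ i → f (suc i))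

-- regard a polynomial in x_2..x_n as a polynomial in x_1..x_n
lift : ∀ {n} → Poly n → Poly (suc n)
lift (con z) = con z
lift (var i) = var (suc i)
lift (p ⊕ q) = lift p ⊕ lift q
lift (p ⊗ q) = lift p ⊗ lift q
lift (⊖ p)   = ⊖ lift p

module _ (R : CommutativeRing 0ℓ 0ℓ) where
  open CommutativeRing R

  natR : ℕ → Carrier
  natR zero    = 0#
  natR (suc k) = 1# + natR k

  intR : ℤ → Carrier
  intR (+ k)      = natR k
  intR -[1+ k ]   = - natR (suc k)

  powR : Carrier → ℕ → Carrier
  powR x zero    = 1#
  powR x (suc k) = x * powR x k

  powℤ : Carrier → Carrier → ℤ → Carrier
  powℤ x xinv (+ k)    = powR x k
  powℤ x xinv -[1+ k ] = powR xinv (suc k)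

  eval : ∀ {n} → (Fin n → Carrier) → Poly n → Carrier
  eval ρ (con z) = intR z
  eval ρ (var i) = ρ i
  eval ρ (p ⊕ q) = eval ρ p + eval ρ q
  eval ρ (p ⊗ q) = eval ρ p * eval ρ q
  eval ρ (⊖ p)   = - eval ρ p

-- Equality in ℤ[x_1..x_n]: equality in the free commutative ring, i.e.
-- equal evaluations in every commutative ring at every point.
infix 4 _≈ₚ_
_≈ₚ_ : ∀ {n} → Poly n → Poly n → Set₁
p ≈ₚ q = ∀ (R : CommutativeRing 0ℓ 0ℓ) ρ →
  CommutativeRing._≈_ R (eval R ρ p) (eval R ρ q)

data Hom {n : ℕ} : ℕ → Poly n → Set where
  hcon : ∀ z → Hom 0 (con z)
  hvar : ∀ i → Hom 1 (var i)
  hadd : ∀ {d p q} → Hom d p → Hom d q → Hom d (p ⊕ q)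
  hmul : ∀ {a b p q} → Hom a p → Hom b q → Hom (a ℕ.+ b) (p ⊗ q)
  hneg : ∀ {d p} → Hom d p → Hom d (⊖ p)

Homogeneous : ∀ {n} → Poly n → Set₁
Homogeneous p = ∃ λ d → ∃ λ p′ → p ≈ₚ p′ × Hom d p′

data Avoids {n : ℕ} (I : Subset n) : Poly n → Set where
  acon : ∀ z → Avoids I (con z)
  avar : ∀ i → lookup I i ≡ outside → Avoids I (var i)
  aadd : ∀ {p q} → Avoids I p → Avoids I q → Avoids I (p ⊕ q)
  amul : ∀ {p q} → Avoids I p → Avoids I q → Avoids I (p ⊗ q)
  aneg : ∀ {p} → Avoids I p → Avoids I (⊖ p)

InVarsOutside : ∀ {n} → Subset n → Poly n → Set₁
InVarsOutside I g = ∃ λ g′ → g ≈ₚ g′ × Avoids I g′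

-- Finite fields, presented (up to isomorphism) on the carrier Fin q.

record FiniteField (q : ℕ) : Set where
  infixl 6 _+_
  infixl 7 _*_
  field
    _+_ _*_ : Op₂ (Fin q)
    -_      : Op₁ (Fin q)
    0# 1#   : Fin q
    isCommutativeRing : IsCommutativeRing _≡_ _+_ _*_ -_ 0# 1#
    0≢1     : 0# ≢ 1#
    inverse : ∀ x → x ≢ 0# → ∃ λ y → x * y ≡ 1#

  ring : CommutativeRing 0ℓ 0ℓ
  ring = record { isCommutativeRing = isCommutativeRing }

allVecs : (q N : ℕ) → List (Vec (Fin q) N)
allVecs q zero    = [] ∷ []
allVecs q (suc N) = concatMap (λ a → List.map (a ∷_) (allVecs q N)) (allFin q)

count : ∀ {A : Set} → (A → Bool) → List A → ℕ
count p xs = length (List.filter (λ x → Data.Bool._≟_ (p x) true) xs)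
  where import Data.Bool

module Counting {q : ℕ} (F : FiniteField q) where
  open FiniteField F using (0#; 1#; ring)

  isZero : Fin q → Bool
  isZero x = does (x Fin.≟ 0#)

  isOne : Fin q → Bool
  isOne x = does (x Fin.≟ 1#)

  someNonzero : ∀ {N} → List (Poly N) → Vec (Fin q) N → Bool
  someNonzero fs x = any (λ f → not (isZero (eval ring (lookup x) f))) fs

  -- canonical representatives of P^{N-1}(F_q): the first nonzero
  -- coordinate equals 1
  isProjRep : ∀ {N} → Vec (Fin q) N → Bool
  isProjRep []       = false
  isProjRep (a ∷ as) = if isZero a then isProjRep as else isOne a

  N̄ℙ : ∀ {N} → List (Poly N) → ℕ
  N̄ℙ {N} fs = count (λ x → if isProjRep x then someNonzero fs x else false) (allVecs q N)

  N̄𝔸 : ∀ {N} → List (Poly N) → ℕ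
  N̄𝔸 {N} fs = count (someNonzero fs) (allVecs q N)

fbar : ∀ {n} (g1 g0 : Poly n) (k : ℕ) → (Fin (suc k) → Poly n) → Poly n
fbar g1 g0 k h = ∑ᵖ (λ i → h i ⊗ (g0 ^ᵖ toℕ i) ⊗ (g1 ^ᵖ (k ∸ toℕ i)))

fhat : ∀ {n} (g0 : Poly n) (k : ℕ) → (Fin (suc k) → Poly n) → Poly n
fhat g0 zero    h = h zero
fhat g0 (suc k) h = h (fromℕ (suc k)) ⊗ g0

substPt : ∀ {n} (R : CommutativeRing 0ℓ 0ℓ) (I : Subset n) →
  CommutativeRing.Carrier R → CommutativeRing.Carrier R →
  (Fin n → CommutativeRing.Carrier R) → Fin n → CommutativeRing.Carrier R
substPt R I gx hinv ρ i with lookup I i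
... | inside  = CommutativeRing._*_ R (CommutativeRing._*_ R (ρ i) gx) hinv
... | outside = ρ i

module Submission where

-- Each is an
-- identity A + D = B + C of natural numbers, obtained in one of two ways:
-- * (1) holds pointwise: f₁f₂ vanishes exactly where f₁ or f₂ does;
-- * (2), (3): B = A + X and D = C + Y, where X and Y count the points of
--   a complement (where the extra polynomials do not vanish but the others
--   do), and X = Y because these sets are in bijection.  The three parts follow; part (2)
-- eliminates x₁ via the root x₁ = g₀/g₁ of f₁, part (3) uses the
-- substitution x_i ↦ x_i g/h, invertible off gh = 0.

open import Data.Nat using (ℕ)
open import Defs

module WeightedSums where
  open import Data.Nat using (ℕ; suc; _+_)
  open import Data.Nat.Properties using (+-assoc; +-commutativeSemigroup)
  open import Algebra.Properties.CommutativeSemigroup +-commutativeSemigroup using (interchange)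
  open import Data.Bool using (Bool; true; false)
  open import Data.List using (List; []; _∷_; _++_; concatMap; map)
  open import Relation.Binary.PropositionalEquality

  ⟦_⟧ : Bool → ℕ
  ⟦ true ⟧  = 1
  ⟦ false ⟧ = 0

  sumOver : ∀ {A : Set} → List A → (A → ℕ) → ℕ
  sumOver []       w = 0
  sumOver (x ∷ xs) w = w x + sumOver xs w

  sumOver-cong : ∀ {A : Set} (xs : List A) {v w : A → ℕ} →
    (∀ x → v x ≡ w x) → sumOver xs v ≡ sumOver xs w
  sumOver-cong []       e = refl
  sumOver-cong (x ∷ xs) e = cong₂ _+_ (e x) (sumOver-cong xs e)

  sumOver-zero : ∀ {A : Set} (xs : List A) → sumOver xs (λ _ → 0) ≡ 0
  sumOver-zero []       = refl
  sumOver-zero (x ∷ xs) = sumOver-zero xs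

  sumOver-+ : ∀ {A : Set} (xs : List A) (v w : A → ℕ) →
    sumOver xs (λ x → v x + w x) ≡ sumOver xs v + sumOver xs w
  sumOver-+ []       v w = refl
  sumOver-+ (x ∷ xs) v w =
    trans (cong (v x + w x +_) (sumOver-+ xs v w)) (interchange (v x) (w x) _ _)

  sumOver-++ : ∀ {A : Set} (xs ys : List A) (w : A → ℕ) →
    sumOver (xs ++ ys) w ≡ sumOver xs w + sumOver ys w
  sumOver-++ []       ys w = refl
  sumOver-++ (x ∷ xs) ys w =
    trans (cong (w x +_) (sumOver-++ xs ys w)) (sym (+-assoc (w x) _ _))

  sumOver-map : ∀ {A B : Set} (f : A → B) (xs : List A) (w : B → ℕ) →
    sumOver (map f xs) w ≡ sumOver xs (λ x → w (f x))
  sumOver-map f []       w = refl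
  sumOver-map f (x ∷ xs) w = cong (w (f x) +_) (sumOver-map f xs w)

  sumOver-concatMap : ∀ {A B : Set} (f : A → List B) (xs : List A) (w : B → ℕ) →
    sumOver (concatMap f xs) w ≡ sumOver xs (λ x → sumOver (f x) w)
  sumOver-concatMap f []       w = refl
  sumOver-concatMap f (x ∷ xs) w =
    trans (sumOver-++ (f x) (concatMap f xs) w) (cong (sumOver (f x) w +_) (sumOver-concatMap f xs w))

  sumOver-swap : ∀ {A B : Set} (xs : List A) (ys : List B) (w : A → B → ℕ) →
    sumOver xs (λ x → sumOver ys (w x)) ≡ sumOver ys (λ y → sumOver xs (λ x → w x y))
  sumOver-swap []       ys w = sym (sumOver-zero ys)
  sumOver-swap (x ∷ xs) ys w =
    trans (cong (sumOver ys (w x) +_) (sumOver-swap xs ys w))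
          (sym (sumOver-+ ys (w x) (λ y → sumOver xs (λ x′ → w x′ y))))

  count≡sumOver : ∀ {A : Set} (p : A → Bool) (xs : List A) → count p xs ≡ sumOver xs (λ x → ⟦ p x ⟧)
  count≡sumOver p []       = refl
  count≡sumOver p (x ∷ xs) with p x
  ... | true  = cong suc (count≡sumOver p xs)
  ... | false = count≡sumOver p xs

  count-+ : ∀ {A : Set} (a b : A → Bool) (xs : List A) →
    count a xs + count b xs ≡ sumOver xs (λ x → ⟦ a x ⟧ + ⟦ b x ⟧)
  count-+ a b xs = trans (cong₂ _+_ (count≡sumOver a xs) (count≡sumOver b xs))
                         (sym (sumOver-+ xs _ _))

  count-partition : ∀ {A : Set} (a b c : A → Bool) (xs : List A) →
    (∀ x → ⟦ a x ⟧ + ⟦ b x ⟧ ≡ ⟦ c x ⟧) → count a xs + count b xs ≡ count c xs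
  count-partition a b c xs e =
    trans (count-+ a b xs) (trans (sumOver-cong xs e) (sym (count≡sumOver c xs)))

  count-exchange : ∀ {A : Set} (a b c d : A → Bool) (xs : List A) →
    (∀ x → ⟦ a x ⟧ + ⟦ b x ⟧ ≡ ⟦ c x ⟧ + ⟦ d x ⟧) →
    count a xs + count b xs ≡ count c xs + count d xs
  count-exchange a b c d xs e =
    trans (count-+ a b xs) (trans (sumOver-cong xs e) (sym (count-+ c d xs)))

module DoubleCounting where
  open import Data.Nat using (ℕ; zero; suc; _+_)
  open import Data.Bool using (Bool; true; false; _∧_)
  open import Data.Bool.Properties using (∧-identityʳ; ∧-zeroʳ)
  open import Function using (_∘_)
  open import Data.List using (List; []; _∷_; allFin; tabulate; concatMap; map)
  open import Data.Fin as Fin using (Fin; zero; suc)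
  open import Data.Vec using (Vec; []; _∷_)
  open import Data.Vec.Properties using (≡-dec)
  open import Data.Product using (_×_; proj₁; proj₂)
  open import Relation.Nullary using (does; yes; no; contradiction)
  open import Relation.Binary.Definitions using (DecidableEquality)
  open import Relation.Binary.PropositionalEquality
  open WeightedSums
  open ≡-Reasoning

  Enumerates : ∀ {A : Set} → DecidableEquality A → List A → Set
  Enumerates _≟_ xs = ∀ a → sumOver xs (λ x → ⟦ does (x ≟ a) ⟧) ≡ 1

  sumOver-point : ∀ {A : Set} (_≟_ : DecidableEquality A) (xs : List A) →
    Enumerates _≟_ xs → ∀ a c → sumOver xs (λ x → ⟦ does (x ≟ a) ∧ c ⟧) ≡ ⟦ c ⟧
  sumOver-point _≟_ xs enum a true  =
    trans (sumOver-cong xs (λ x → cong ⟦_⟧ (∧-identityʳ (does (x ≟ a))))) (enum a)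
  sumOver-point _≟_ xs enum a false =
    trans (sumOver-cong xs (λ x → cong ⟦_⟧ (∧-zeroʳ (does (x ≟ a))))) (sumOver-zero xs)

  module _ {A B : Set} (_≟A_ : DecidableEquality A) (_≟B_ : DecidableEquality B)
           (P : A → Bool) (Q : B → Bool) (s : A → B) (t : B → A)
           (PQ : ∀ x → P x ≡ true → Q (s x) ≡ true × t (s x) ≡ x)
           (QP : ∀ y → Q y ≡ true → P (t y) ≡ true × s (t y) ≡ y) where

    -- s and t restrict to mutually inverse bijections, so the graph of s
    -- on P is the transposed graph of t on Q
    graph-symmetric : ∀ x y → (does (y ≟B s x) ∧ P x) ≡ (does (x ≟A t y) ∧ Q y)
    graph-symmetric x y with y ≟B s x | x ≟A t y
    ... | yes refl | yes x≡ty with P x in Px | Q (s x) in Qy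
    ...   | true  | _     = trans (sym (proj₁ (PQ x Px))) Qy
    ...   | false | true  = trans (sym Px) (subst (λ z → P z ≡ true) (sym x≡ty) (proj₁ (QP _ Qy)))
    ...   | false | false = refl
    graph-symmetric x y | yes refl | no x≢ty with P x in Px
    ...   | true  = contradiction (sym (proj₂ (PQ x Px))) x≢ty
    ...   | false = refl
    graph-symmetric x y | no y≢sx | yes refl with Q y in Qy
    ...   | true  = contradiction (sym (proj₂ (QP y Qy))) y≢sx
    ...   | false = refl
    graph-symmetric x y | no _ | no _ = refl

    -- count the pairs (x, y) with P x and y = s x in both orders
    count-bijection : (xs : List A) (ys : List B) →
      Enumerates _≟A_ xs → Enumerates _≟B_ ys → count P xs ≡ count Q ys
    count-bijection xs ys enumA enumB = begin
      count P xs
        ≡⟨ count≡sumOver P xs ⟩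
      sumOver xs (λ x → ⟦ P x ⟧)
        ≡⟨ sumOver-cong xs (λ x → sym (sumOver-point _≟B_ ys enumB (s x) (P x))) ⟩
      sumOver xs (λ x → sumOver ys (λ y → ⟦ does (y ≟B s x) ∧ P x ⟧))
        ≡⟨ sumOver-swap xs ys _ ⟩
      sumOver ys (λ y → sumOver xs (λ x → ⟦ does (y ≟B s x) ∧ P x ⟧))
        ≡⟨ sumOver-cong ys (λ y → sumOver-cong xs (λ x → cong ⟦_⟧ (graph-symmetric x y))) ⟩
      sumOver ys (λ y → sumOver xs (λ x → ⟦ does (x ≟A t y) ∧ Q y ⟧))
        ≡⟨ sumOver-cong ys (λ y → sumOver-point _≟A_ xs enumA (t y) (Q y)) ⟩
      sumOver ys (λ y → ⟦ Q y ⟧)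
        ≡⟨ sym (count≡sumOver Q ys) ⟩
      count Q ys ∎

  sumOver-tabulate : ∀ {A : Set} {n} (f : Fin n → A) (w : A → ℕ) →
    sumOver (tabulate f) w ≡ sumOver (allFin n) (λ i → w (f i))
  sumOver-tabulate {n = zero}  f w = refl
  sumOver-tabulate {n = suc n} f w = cong (w (f zero) +_)
    (trans (sumOver-tabulate (f ∘ Fin.suc) w) (sym (sumOver-tabulate Fin.suc (w ∘ f))))

  allFin-enumerates : ∀ n → Enumerates Fin._≟_ (allFin n)
  allFin-enumerates (suc n) zero    =
    cong suc (trans (sumOver-tabulate {n = n} Fin.suc (λ b → ⟦ does (b Fin.≟ zero) ⟧)) (sumOver-zero (allFin n)))
  allFin-enumerates (suc n) (suc a) =
    trans (sumOver-tabulate {n = n} Fin.suc (λ b → ⟦ does (b Fin.≟ suc a) ⟧)) (allFin-enumerates n a)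

  allVecs-enumerates : ∀ q N → Enumerates (≡-dec Fin._≟_) (allVecs q N)
  allVecs-enumerates q zero    []       = refl
  allVecs-enumerates q (suc N) (a ∷ as) = begin
    sumOver (concatMap (λ b → map (b ∷_) (allVecs q N)) (allFin q)) δ
      ≡⟨ sumOver-concatMap _ (allFin q) δ ⟩
    sumOver (allFin q) (λ b → sumOver (map (b ∷_) (allVecs q N)) δ)
      ≡⟨ sumOver-cong (allFin q) (λ b → sumOver-map (b ∷_) (allVecs q N) δ) ⟩
    sumOver (allFin q) (λ b → sumOver (allVecs q N) (λ x → ⟦ does (b Fin.≟ a) ∧ does (≡-dec Fin._≟_ x as) ⟧))
      ≡⟨ sumOver-cong (allFin q) fibre ⟩
    sumOver (allFin q) (λ b → ⟦ does (b Fin.≟ a) ⟧)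
      ≡⟨ allFin-enumerates q a ⟩
    1 ∎
    where
    δ : Vec (Fin q) (suc N) → ℕ
    δ x = ⟦ does (≡-dec Fin._≟_ x (a ∷ as)) ⟧
    fibre : ∀ b → sumOver (allVecs q N) (λ x → ⟦ does (b Fin.≟ a) ∧ does (≡-dec Fin._≟_ x as) ⟧)
                  ≡ ⟦ does (b Fin.≟ a) ⟧
    fibre b with b Fin.≟ a
    ... | yes _ = allVecs-enumerates q N as
    ... | no _  = sumOver-zero (allVecs q N)

module FieldFacts {q : ℕ} (F : FiniteField q) where
  open import Data.Nat as ℕ using (zero; suc)
  open import Data.Fin as Fin using (Fin)
  open import Data.Bool using (true; false; _∨_)
  open import Data.Maybe using (nothing)
  open import Data.Product using (proj₁; proj₂)
  open import Data.Sum using (_⊎_; inj₁; inj₂)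
  open import Relation.Nullary using (yes; no; contradiction)
  open import Relation.Nullary.Decidable using (dec-true; dec-false)
  open import Relation.Binary.PropositionalEquality
  open import Algebra.Bundles using (CommutativeRing)
  open FiniteField F public using (_+_; _*_; -_; 0#; 1#; ring)
  open FiniteField F using (0≢1; inverse)
  open CommutativeRing ring public using (Carrier)
  open CommutativeRing ring using (zeroˡ; zeroʳ; *-identityˡ; *-identityʳ; *-comm; *-assoc; commutativeSemiring)
  open Counting F public using (isZero; isOne; someNonzero; isProjRep; N̄ℙ; N̄𝔸)
  open import Algebra.Properties.Ring (CommutativeRing.ring ring) using (-0#≈0#; -‿injective)
  open import Algebra.Solver.Ring.NaturalCoefficients commutativeSemiring (λ _ _ → nothing) public
    using (solve; _:*_; _:=_)
  open ≡-Reasoning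

  isZero-≡0 : ∀ {x} → isZero x ≡ true → x ≡ 0#
  isZero-≡0 {x} e with x Fin.≟ 0#
  ... | yes x≡0 = x≡0

  isZero-≢0 : ∀ {x} → isZero x ≡ false → x ≢ 0#
  isZero-≢0 {x} e with x Fin.≟ 0#
  ... | no x≢0 = x≢0

  ≡0-isZero : ∀ {x} → x ≡ 0# → isZero x ≡ true
  ≡0-isZero {x} = dec-true (x Fin.≟ 0#)

  ≢0-isZero : ∀ {x} → x ≢ 0# → isZero x ≡ false
  ≢0-isZero {x} = dec-false (x Fin.≟ 0#)

  1≢0 : 1# ≢ 0#
  1≢0 1≡0 = 0≢1 (sym 1≡0)

  -- a chosen inverse (0⁻¹ = 0); opaque, so that only inv-r describes it
  opaque
    inv : Carrier → Carrier
    inv a with a Fin.≟ 0#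
    ... | yes _   = 0#
    ... | no a≢0 = proj₁ (inverse a a≢0)

    inv-r : ∀ {a} → a ≢ 0# → a * inv a ≡ 1#
    inv-r {a} a≢0 with a Fin.≟ 0#
    ... | yes a≡0  = contradiction a≡0 a≢0
    ... | no a≢0′ = proj₂ (inverse a a≢0′)

  inv-l : ∀ {a} → a ≢ 0# → inv a * a ≡ 1#
  inv-l {a} a≢0 = trans (*-comm (inv a) a) (inv-r a≢0)

  invertible-≢0 : ∀ {a b} → a * b ≡ 1# → a ≢ 0#
  invertible-≢0 {a} {b} ab≡1 a≡0 = 0≢1 (begin
    0#     ≡⟨ sym (zeroˡ b) ⟩
    0# * b ≡⟨ cong (_* b) (sym a≡0) ⟩
    a * b  ≡⟨ ab≡1 ⟩
    1#     ∎)

  *-cancelˡ : ∀ {a b c} → a ≢ 0# → a * b ≡ a * c → b ≡ c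
  *-cancelˡ {a} {b} {c} a≢0 e = begin
    b             ≡⟨ sym (*-identityˡ b) ⟩
    1# * b        ≡⟨ cong (_* b) (sym (inv-l a≢0)) ⟩
    inv a * a * b ≡⟨ *-assoc (inv a) a b ⟩
    inv a * (a * b) ≡⟨ cong (inv a *_) e ⟩
    inv a * (a * c) ≡⟨ sym (*-assoc (inv a) a c) ⟩
    inv a * a * c ≡⟨ cong (_* c) (inv-l a≢0) ⟩
    1# * c        ≡⟨ *-identityˡ c ⟩
    c             ∎

  *-≡0 : ∀ {a b} → a * b ≡ 0# → a ≡ 0# ⊎ b ≡ 0#
  *-≡0 {a} {b} e with a Fin.≟ 0#
  ... | yes a≡0 = inj₁ a≡0
  ... | no a≢0  = inj₂ (*-cancelˡ a≢0 (trans e (sym (zeroʳ a))))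

  *-≢0 : ∀ {a b} → a ≢ 0# → b ≢ 0# → a * b ≢ 0#
  *-≢0 a≢0 b≢0 ab≡0 with *-≡0 ab≡0
  ... | inj₁ a≡0 = a≢0 a≡0
  ... | inj₂ b≡0 = b≢0 b≡0

  isZero-* : ∀ a b → isZero (a * b) ≡ (isZero a ∨ isZero b)
  isZero-* a b with a Fin.≟ 0# | b Fin.≟ 0#
  ... | yes refl | _        = ≡0-isZero (zeroˡ b)
  ... | no _     | yes refl = ≡0-isZero (zeroʳ a)
  ... | no a≢0   | no b≢0   = ≢0-isZero (*-≢0 a≢0 b≢0)

  isZero-unitʳ : ∀ a {b} → b ≢ 0# → isZero (a * b) ≡ isZero a
  isZero-unitʳ a {b} b≢0 with a Fin.≟ 0#
  ... | yes refl = ≡0-isZero (zeroˡ b)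
  ... | no a≢0   = ≢0-isZero (*-≢0 a≢0 b≢0)

  isZero-unitˡ : ∀ {a} b → a ≢ 0# → isZero (a * b) ≡ isZero b
  isZero-unitˡ {a} b a≢0 = trans (cong isZero (*-comm a b)) (isZero-unitʳ b a≢0)

  isZero-neg : ∀ a → isZero (- a) ≡ isZero a
  isZero-neg a with a Fin.≟ 0#
  ... | yes refl = ≡0-isZero -0#≈0#
  ... | no a≢0   = ≢0-isZero (λ -a≡0 → a≢0 (-‿injective (trans -a≡0 (sym -0#≈0#))))

  solve-for : ∀ {b u v} → b ≢ 0# → b * u ≡ v → u ≡ v * inv b
  solve-for {b} {u} {v} b≢0 bu≡v = begin
    u             ≡⟨ sym (*-identityʳ u) ⟩
    u * 1#        ≡⟨ cong (u *_) (sym (inv-r b≢0)) ⟩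
    u * (b * inv b) ≡⟨ solve 3 (λ u b i → u :* (b :* i) := b :* u :* i) refl u b (inv b) ⟩
    b * u * inv b ≡⟨ cong (_* inv b) bu≡v ⟩
    v * inv b     ∎

  inv-unique : ∀ {a b} → a * b ≡ 1# → b ≡ inv a
  inv-unique ab≡1 = *-cancelˡ (invertible-≢0 ab≡1) (trans ab≡1 (sym (inv-r (invertible-≢0 ab≡1))))

  inv-≢0 : ∀ {a} → a ≢ 0# → inv a ≢ 0#
  inv-≢0 a≢0 = invertible-≢0 (inv-l a≢0)

  pw : Carrier → ℕ → Carrier
  pw = powR ring

  pw-≢0 : ∀ {a} k → a ≢ 0# → pw a k ≢ 0#
  pw-≢0 zero    a≢0 = 1≢0
  pw-≢0 (suc k) a≢0 = *-≢0 a≢0 (pw-≢0 k a≢0)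

  isZero-pw : ∀ a k → isZero (pw a (suc k)) ≡ isZero a
  isZero-pw a k with a Fin.≟ 0#
  ... | yes refl = ≡0-isZero (zeroˡ _)
  ... | no a≢0   = ≢0-isZero (pw-≢0 (suc k) a≢0)

  pw-+ : ∀ a m n → pw a (m ℕ.+ n) ≡ pw a m * pw a n
  pw-+ a zero    n = sym (*-identityˡ _)
  pw-+ a (suc m) n = trans (cong (a *_) (pw-+ a m n)) (sym (*-assoc a _ _))

  pw-* : ∀ a b n → pw (a * b) n ≡ pw a n * pw b n
  pw-* a b zero    = sym (*-identityʳ 1#)
  pw-* a b (suc n) = trans (cong (a * b *_) (pw-* a b n))
    (solve 4 (λ a b u v → a :* b :* (u :* v) := a :* u :* (b :* v)) refl a b (pw a n) (pw b n))

module Evaluation {q : ℕ} (F : FiniteField q) where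
  open import Data.Nat as ℕ using (zero; suc)
  open import Data.Fin as Fin using (Fin; zero; suc)
  open import Data.Bool using (not; _∨_)
  open import Data.List using (tabulate)
  open import Data.Vec as Vec using (Vec; lookup; _∷_)
  open import Data.Vec.Properties using (lookup-map)
  open import Data.Product using (∃; _,_)
  open import Function using (_∘_)
  open import Relation.Binary.PropositionalEquality
  open import Algebra.Bundles using (CommutativeRing)
  open FieldFacts F
  open import Algebra.Properties.Ring (CommutativeRing.ring ring) using (-‿distribʳ-*)
  open CommutativeRing ring using (*-identityˡ; *-identityʳ; +-identityʳ; distribˡ; semiring)
  open import Algebra.Properties.Semiring.Sum semiring public using (sum)
  open ≡-Reasoning

  ev : ∀ {N} → Vec Carrier N → Poly N → Carrier
  ev x p = eval ring (lookup x) p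

  eval-cong : ∀ {n} {ρ ρ′ : Fin n → Carrier} → (∀ i → ρ i ≡ ρ′ i) →
    ∀ p → eval ring ρ p ≡ eval ring ρ′ p
  eval-cong e (con z)  = refl
  eval-cong e (var i)  = e i
  eval-cong e (p ⊕ p′) = cong₂ _+_ (eval-cong e p) (eval-cong e p′)
  eval-cong e (p ⊗ p′) = cong₂ _*_ (eval-cong e p) (eval-cong e p′)
  eval-cong e (⊖ p)    = cong -_ (eval-cong e p)

  eval-pow : ∀ {n} (ρ : Fin n → Carrier) p k → eval ring ρ (p ^ᵖ k) ≡ pw (eval ring ρ p) k
  eval-pow ρ p zero    = +-identityʳ 1#
  eval-pow ρ p (suc k) = cong (eval ring ρ p *_) (eval-pow ρ p k)

  eval-lift : ∀ {n} (ρ : Fin (suc n) → Carrier) p → eval ring ρ (lift p) ≡ eval ring (ρ ∘ suc) p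
  eval-lift ρ (con z)  = refl
  eval-lift ρ (var i)  = refl
  eval-lift ρ (p ⊕ p′) = cong₂ _+_ (eval-lift ρ p) (eval-lift ρ p′)
  eval-lift ρ (p ⊗ p′) = cong₂ _*_ (eval-lift ρ p) (eval-lift ρ p′)
  eval-lift ρ (⊖ p)    = cong -_ (eval-lift ρ p)

  lift-at : ∀ {N} a (y : Vec Carrier N) p → ev (a ∷ y) (lift p) ≡ ev y p
  lift-at a y p = eval-lift (lookup (a ∷ y)) p

  eval-∑ : ∀ {n k} (ρ : Fin n → Carrier) (G : Fin k → Poly n) →
    eval ring ρ (∑ᵖ G) ≡ sum (λ i → eval ring ρ (G i))
  eval-∑ {k = zero}  ρ G = refl
  eval-∑ {k = suc k} ρ G = cong (eval ring ρ (G zero) +_) (eval-∑ ρ (G ∘ suc))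

  scale : ∀ {N} → Carrier → Vec Carrier N → Vec Carrier N
  scale c = Vec.map (c *_)

  hom-scale : ∀ {n d} {p : Poly n} → Hom d p → ∀ c (ρ : Fin n → Carrier) →
    eval ring (λ i → c * ρ i) p ≡ pw c d * eval ring ρ p
  hom-scale (hcon z) c ρ = sym (*-identityˡ _)
  hom-scale (hvar i) c ρ = cong (_* ρ i) (sym (*-identityʳ c))
  hom-scale (hadd hp hq) c ρ =
    trans (cong₂ _+_ (hom-scale hp c ρ) (hom-scale hq c ρ)) (sym (distribˡ _ _ _))
  hom-scale (hmul {a} {b} {p} {p′} hp hq) c ρ = begin
    eval ring (λ i → c * ρ i) p * eval ring (λ i → c * ρ i) p′
      ≡⟨ cong₂ _*_ (hom-scale hp c ρ) (hom-scale hq c ρ) ⟩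
    pw c a * u * (pw c b * v)
      ≡⟨ solve 4 (λ x y u v → x :* u :* (y :* v) := x :* y :* (u :* v)) refl (pw c a) (pw c b) u v ⟩
    pw c a * pw c b * (u * v)
      ≡⟨ cong (_* (u * v)) (sym (pw-+ c a b)) ⟩
    pw c (a ℕ.+ b) * (u * v) ∎
    where
    u = eval ring ρ p
    v = eval ring ρ p′
  hom-scale (hneg hp) c ρ = trans (cong -_ (hom-scale hp c ρ)) (-‿distribʳ-* _ _)

  homogeneous-scale : ∀ {N} {p : Poly N} → Homogeneous p →
    ∃ λ d → ∀ c (x : Vec Carrier N) → ev (scale c x) p ≡ pw c d * ev x p
  homogeneous-scale {p = p} (d , p′ , p≈p′ , hom) = d , λ c x → begin
    ev (scale c x) p                 ≡⟨ p≈p′ ring _ ⟩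
    ev (scale c x) p′                ≡⟨ eval-cong (λ i → lookup-map i (c *_) x) p′ ⟩
    eval ring (λ i → c * lookup x i) p′ ≡⟨ hom-scale hom c (lookup x) ⟩
    pw c d * ev x p′                 ≡⟨ cong (pw c d *_) (sym (p≈p′ ring _)) ⟩
    pw c d * ev x p                  ∎

  homogeneous-zero-invariant : ∀ {N} {p : Poly N} → Homogeneous p →
    ∀ {c} (x : Vec Carrier N) → c ≢ 0# → isZero (ev (scale c x) p) ≡ isZero (ev x p)
  homogeneous-zero-invariant {p = p} hp {c} x c≢0 with homogeneous-scale {p = p} hp
  ... | d , scaling = trans (cong isZero (scaling c x)) (isZero-unitˡ (ev x p) (pw-≢0 d c≢0))

  someNonzero-cong : ∀ {N M m} (G : Fin m → Poly N) (H : Fin m → Poly M) x y →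
    (∀ j → isZero (ev x (G j)) ≡ isZero (ev y (H j))) →
    someNonzero (tabulate G) x ≡ someNonzero (tabulate H) y
  someNonzero-cong {m = zero}  G H x y e = refl
  someNonzero-cong {m = suc m} G H x y e =
    cong₂ _∨_ (cong not (e zero)) (someNonzero-cong (G ∘ suc) (H ∘ suc) x y (e ∘ suc))

module ProjectivePoints {q : ℕ} (F : FiniteField q) where
  open import Data.Fin as Fin using (Fin)
  open import Data.Bool using (Bool; true; false; _∧_; if_then_else_)
  open import Data.Bool.Properties using (∧-conicalˡ; ∧-conicalʳ)
  open import Data.Vec as Vec using (Vec; []; _∷_)
  open import Data.Vec.Properties using (map-∘; map-cong; map-id; ≡-dec)
  open import Data.Vec.Relation.Unary.Any using (Any; here; there)
  open import Data.Product using (∃; _×_; _,_)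
  open import Data.Sum using (_⊎_; inj₁; inj₂)
  open import Data.List using (List)
  open import Function using (_∘′_)
  open import Relation.Nullary using (yes; no; contradiction)
  open import Relation.Nullary.Decidable using (dec-true)
  open import Relation.Binary.PropositionalEquality
  open import Algebra.Bundles using (CommutativeRing)
  open FieldFacts F
  open Evaluation F using (scale)
  open DoubleCounting using (count-bijection; allVecs-enumerates)
  open CommutativeRing ring using (zeroˡ; zeroʳ; *-identityˡ; *-identityʳ; *-assoc)
  open ≡-Reasoning

  inℙ : ∀ {N} → List (Poly N) → Vec Carrier N → Bool
  inℙ gs x = if isProjRep x then someNonzero gs x else false

  NonZeroVec : ∀ {N} → Vec Carrier N → Set
  NonZeroVec = Any (_≢ 0#)

  -- every vector is nonzero or the zero vector (which 0 · v is)
  zero-or-nonzero : ∀ {N} (v : Vec Carrier N) → NonZeroVec v ⊎ scale 0# v ≡ v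
  zero-or-nonzero []      = inj₂ refl
  zero-or-nonzero (a ∷ v) with a Fin.≟ 0# | zero-or-nonzero v
  ... | no a≢0   | _         = inj₁ (here a≢0)
  ... | yes _    | inj₁ nz   = inj₁ (there nz)
  ... | yes a≡0  | inj₂ 0v≡v = inj₂ (cong₂ _∷_ (trans (zeroˡ a) (sym a≡0)) 0v≡v)

  normalize : ∀ {N} → Vec Carrier N → Vec Carrier N
  normalize []       = []
  normalize (a ∷ as) = if isZero a then a ∷ normalize as else scale (inv a) (a ∷ as)

  scale-scale : ∀ {N} a b (v : Vec Carrier N) → scale a (scale b v) ≡ scale (a * b) v
  scale-scale a b v = trans (sym (map-∘ (a *_) (b *_) v)) (map-cong (λ x → sym (*-assoc a b x)) v)

  scale-one : ∀ {N} (v : Vec Carrier N) → scale 1# v ≡ v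
  scale-one v = trans (map-cong *-identityˡ v) (map-id v)

  isOne-1 : isOne 1# ≡ true
  isOne-1 = dec-true (1# Fin.≟ 1#) refl

  isOne-≡1 : ∀ {a} → isOne a ≡ true → a ≡ 1#
  isOne-≡1 {a} e with a Fin.≟ 1#
  ... | yes a≡1 = a≡1

  leading-one-rep : ∀ {N} (v : Vec Carrier N) → isProjRep (1# ∷ v) ≡ true
  leading-one-rep v rewrite ≢0-isZero 1≢0 = isOne-1

  normalize-scales : ∀ {N} (v : Vec Carrier N) → ∃ λ c → c ≢ 0# × normalize v ≡ scale c v
  normalize-scales []       = 1# , 1≢0 , refl
  normalize-scales (a ∷ as) with isZero a in z
  ... | false = inv a , inv-≢0 (isZero-≢0 z) , refl
  ... | true with normalize-scales as
  ...   | c , c≢0 , e = c , c≢0 , cong₂ _∷_ (trans a≡0 (sym (trans (cong (c *_) a≡0) (zeroʳ c)))) e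
    where a≡0 = isZero-≡0 z

  normalize-rep : ∀ {N} {v : Vec Carrier N} → NonZeroVec v → isProjRep (normalize v) ≡ true
  normalize-rep {v = a ∷ as} nz with isZero a in z
  normalize-rep {v = a ∷ as} (here a≢0) | true = contradiction (isZero-≡0 z) a≢0
  normalize-rep {v = a ∷ as} (there nz) | true rewrite z = normalize-rep nz
  normalize-rep {v = a ∷ as} nz         | false =
    trans (cong (λ b → isProjRep (b ∷ scale (inv a) as)) (inv-l (isZero-≢0 z))) (leading-one-rep (scale (inv a) as))

  normalize-zero-head : ∀ {N} {a} (as : Vec Carrier N) → a ≡ 0# → normalize (a ∷ as) ≡ a ∷ normalize as
  normalize-zero-head {a = a} as a≡0 with isZero a | ≡0-isZero a≡0
  ... | .true | refl = refl

  normalize-nonzero-head : ∀ {N} {a} (as : Vec Carrier N) → a ≢ 0# →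
    normalize (a ∷ as) ≡ scale (inv a) (a ∷ as)
  normalize-nonzero-head {a = a} as a≢0 with isZero a | ≢0-isZero a≢0
  ... | .false | refl = refl

  normalize-invariant : ∀ {N} {c} (v : Vec Carrier N) → c ≢ 0# → normalize (scale c v) ≡ normalize v
  normalize-invariant []       c≢0 = refl
  normalize-invariant {c = c} (a ∷ as) c≢0 with isZero a in z
  ... | true = trans (normalize-zero-head (scale c as) ca≡0)
                     (cong₂ _∷_ (trans ca≡0 (sym a≡0)) (normalize-invariant as c≢0))
    where
    a≡0  = isZero-≡0 z
    ca≡0 = trans (cong (c *_) a≡0) (zeroʳ c)
  ... | false = begin
    normalize (scale c (a ∷ as))           ≡⟨ normalize-nonzero-head (scale c as) (*-≢0 c≢0 (isZero-≢0 z)) ⟩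
    scale (inv (c * a)) (scale c (a ∷ as)) ≡⟨ scale-scale (inv (c * a)) c (a ∷ as) ⟩
    scale (inv (c * a) * c) (a ∷ as)       ≡⟨ cong (λ z → scale z (a ∷ as)) (inv-unique inverse-of-a) ⟩
    scale (inv a) (a ∷ as)                 ∎
    where
    inverse-of-a : a * (inv (c * a) * c) ≡ 1#
    inverse-of-a = trans (solve 3 (λ a i c → a :* (i :* c) := c :* a :* i) refl a (inv (c * a)) c)
                         (inv-r (*-≢0 c≢0 (isZero-≢0 z)))

  normalize-fixes-rep : ∀ {N} (x : Vec Carrier N) → isProjRep x ≡ true → normalize x ≡ x
  normalize-fixes-rep (a ∷ as) rep with isZero a
  ... | true  = cong (a ∷_) (normalize-fixes-rep as rep)
  ... | false = trans (cong (λ z → scale z (a ∷ as)) (sym (inv-unique a*1≡1))) (scale-one (a ∷ as))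
    where
    a*1≡1 : a * 1# ≡ 1#
    a*1≡1 = trans (*-identityʳ a) (isOne-≡1 rep)

  rep-nonzero : ∀ {N} (x : Vec Carrier N) → isProjRep x ≡ true → NonZeroVec x
  rep-nonzero (a ∷ as) rep with isZero a in z
  ... | true  = there (rep-nonzero as rep)
  ... | false = here (isZero-≢0 z)

  descend : ∀ {N M} (P : Vec Carrier N → Bool) (Q : Vec Carrier M → Bool)
    (s : Vec Carrier N → Vec Carrier M) (t : Vec Carrier M → Vec Carrier N) →
    (∀ {c} y → c ≢ 0# → Q (scale c y) ≡ Q y) →
    (∀ {c} y → c ≢ 0# → Q y ≡ true → t (scale c y) ≡ scale c (t y)) →
    (∀ x → isProjRep x ≡ true → P x ≡ true → NonZeroVec (s x)) →
    (∀ x → P x ≡ true → Q (s x) ≡ true × t (s x) ≡ x) →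
    ∀ x → (isProjRep x ∧ P x) ≡ true →
    (isProjRep (normalize (s x)) ∧ Q (normalize (s x))) ≡ true × normalize (t (normalize (s x))) ≡ x
  descend P Q s t Q-invariant t-equivariant s-nonzero PQ x repP
    with normalize-scales (s x) | PQ x (∧-conicalʳ _ _ repP)
  ... | c , c≢0 , norm≡ | Qsx , tsx≡x =
    cong₂ _∧_ (normalize-rep (s-nonzero x rep (∧-conicalʳ _ _ repP)))
              (trans (cong Q norm≡) (trans (Q-invariant (s x) c≢0) Qsx)) ,
    (begin
      normalize (t (normalize (s x))) ≡⟨ cong (normalize ∘′ t) norm≡ ⟩
      normalize (t (scale c (s x)))   ≡⟨ cong normalize (t-equivariant (s x) c≢0 Qsx) ⟩
      normalize (scale c (t (s x)))   ≡⟨ normalize-invariant (t (s x)) c≢0 ⟩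
      normalize (t (s x))             ≡⟨ cong normalize tsx≡x ⟩
      normalize x                     ≡⟨ normalize-fixes-rep x rep ⟩
      x                               ∎)
    where
    rep = ∧-conicalˡ _ _ repP

  projective-bijection : ∀ {N M} (P : Vec Carrier N → Bool) (Q : Vec Carrier M → Bool)
    (s : Vec Carrier N → Vec Carrier M) (t : Vec Carrier M → Vec Carrier N) →
    (∀ {c} x → c ≢ 0# → P (scale c x) ≡ P x) →
    (∀ {c} y → c ≢ 0# → Q (scale c y) ≡ Q y) →
    (∀ {c} x → c ≢ 0# → P x ≡ true → s (scale c x) ≡ scale c (s x)) →
    (∀ {c} y → c ≢ 0# → Q y ≡ true → t (scale c y) ≡ scale c (t y)) →
    (∀ x → isProjRep x ≡ true → P x ≡ true → NonZeroVec (s x)) →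
    (∀ y → isProjRep y ≡ true → Q y ≡ true → NonZeroVec (t y)) →
    (∀ x → P x ≡ true → Q (s x) ≡ true × t (s x) ≡ x) →
    (∀ y → Q y ≡ true → P (t y) ≡ true × s (t y) ≡ y) →
    count (λ x → isProjRep x ∧ P x) (allVecs q N) ≡ count (λ y → isProjRep y ∧ Q y) (allVecs q M)
  projective-bijection {N} {M} P Q s t P-inv Q-inv s-equiv t-equiv s-nz t-nz PQ QP =
    count-bijection (≡-dec Fin._≟_) (≡-dec Fin._≟_)
      (λ x → isProjRep x ∧ P x) (λ y → isProjRep y ∧ Q y)
      (λ x → normalize (s x)) (λ y → normalize (t y))
      (descend P Q s t Q-inv t-equiv s-nz PQ) (descend Q P t s P-inv s-equiv t-nz QP)
      (allVecs q N) (allVecs q M) (allVecs-enumerates q N) (allVecs-enumerates q M)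

module Rearrangement where
  open import Data.Nat as ℕ using (ℕ)
  open import Data.Nat.Properties using (+-assoc; +-comm)
  open import Data.Integer using (+_; _+_; _-_)
  open import Data.Integer.Properties using (pos-+)
  open import Data.Integer.Tactic.RingSolver using (solve-∀)
  open import Relation.Binary.PropositionalEquality
  open ≡-Reasoning

  exchange-ℤ : ∀ A B C D → A ℕ.+ D ≡ B ℕ.+ C → + A ≡ + B + + C - + D
  exchange-ℤ A B C D e = begin
    + A               ≡⟨ add-sub (+ A) (+ D) ⟩
    + A + + D - + D   ≡⟨ cong (_- + D) (sym (pos-+ A D)) ⟩
    + (A ℕ.+ D) - + D ≡⟨ cong (λ z → + z - + D) e ⟩
    + (B ℕ.+ C) - + D ≡⟨ cong (_- + D) (pos-+ B C) ⟩
    + B + + C - + D   ∎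
    where
    add-sub : ∀ a d → a ≡ a + d - d
    add-sub = solve-∀

  complement : ∀ A B C D X → A ℕ.+ X ≡ B → C ℕ.+ X ≡ D → A ℕ.+ D ≡ B ℕ.+ C
  complement A B C D X AX≡B CX≡D = begin
    A ℕ.+ D         ≡⟨ cong (A ℕ.+_) (sym CX≡D) ⟩
    A ℕ.+ (C ℕ.+ X) ≡⟨ cong (A ℕ.+_) (+-comm C X) ⟩
    A ℕ.+ (X ℕ.+ C) ≡⟨ sym (+-assoc A X C) ⟩
    A ℕ.+ X ℕ.+ C   ≡⟨ cong (ℕ._+ C) AX≡B ⟩
    B ℕ.+ C         ∎

-- Part (1): f₁f₂ vanishes exactly where f₁ or f₂ does, so pointwise on
-- P^{n-1} the indicators satisfy [f₁f₂,fs] + [f₁,f₂,fs] = [f₁,fs] + [f₂,fs].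
module PartOne {q : ℕ} (F : FiniteField q) where
  open import Data.Nat as ℕ using ()
  open import Data.Nat.Properties using (+-comm)
  open import Data.Bool using (true; false; not; _∨_)
  open import Data.List using (List; _∷_)
  open import Relation.Binary.PropositionalEquality
  open WeightedSums using (⟦_⟧; count-exchange)
  open FieldFacts F
  open Evaluation F using (ev)
  open ProjectivePoints F using (inℙ)

  -- the Boolean identity behind (1): z₁, z₂ say whether f₁, f₂ vanish,
  -- s whether some other f_j does not
  product-indicator : ∀ z₁ z₂ s →
    ⟦ not (z₁ ∨ z₂) ∨ s ⟧ ℕ.+ ⟦ not z₁ ∨ (not z₂ ∨ s) ⟧ ≡ ⟦ not z₁ ∨ s ⟧ ℕ.+ ⟦ not z₂ ∨ s ⟧
  product-indicator true  true  s = refl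
  product-indicator true  false s = refl
  product-indicator false true  s = +-comm ⟦ s ⟧ 1
  product-indicator false false s = refl

  part1 : ∀ {n} (f₁ f₂ : Poly n) (fs : List (Poly n)) →
    N̄ℙ (f₁ ⊗ f₂ ∷ fs) ℕ.+ N̄ℙ (f₁ ∷ f₂ ∷ fs) ≡ N̄ℙ (f₁ ∷ fs) ℕ.+ N̄ℙ (f₂ ∷ fs)
  part1 {n} f₁ f₂ fs =
    count-exchange (inℙ (f₁ ⊗ f₂ ∷ fs)) (inℙ (f₁ ∷ f₂ ∷ fs)) (inℙ (f₁ ∷ fs)) (inℙ (f₂ ∷ fs))
      (allVecs q n) pointwise
    where
    pointwise : ∀ x → ⟦ inℙ (f₁ ⊗ f₂ ∷ fs) x ⟧ ℕ.+ ⟦ inℙ (f₁ ∷ f₂ ∷ fs) x ⟧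
                      ≡ ⟦ inℙ (f₁ ∷ fs) x ⟧ ℕ.+ ⟦ inℙ (f₂ ∷ fs) x ⟧
    pointwise x with isProjRep x
    ... | false = refl
    ... | true rewrite isZero-* (ev x f₁) (ev x f₂) =
      product-indicator (isZero (ev x f₁)) (isZero (ev x f₂)) (someNonzero fs x)

-- Where g₁(y) ≠ 0 the equation f₁ = 0 has the single solution
-- x₁ = g₀(y)/g₁(y), and there f̄_j(y) = g₁(y)^{k_j} f_j(g₀/g₁, y); where
-- g₁(y) = 0, f̄_j(y) = h_{j,k_j}(y) g₀(y)^{k_j} vanishes iff f̂_j(y) does.
-- Hence, with X = #{x ∈ P^{n-1} : f₁ = f_j = 0, g₁ ≠ 0} and
-- Y = #{y ∈ P^{n-2} : g₁ ≠ 0, f̄_j = 0}: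
--   N̄(g₁,g₀,f) = N̄(f₁,f) + X,  N̄(g₁,f̂) = N̄(f̄) + Y,  X = Y,
-- the last via x ↦ (x₂..x_n), y ↦ (g₀(y)/g₁(y), y), which commute with
-- scaling by homogeneity of f₁ and the f_j.
module PartTwo {q : ℕ} (F : FiniteField q) where
  open import Data.Nat as ℕ using (zero; suc; _∸_)
  import Data.Nat.Properties as ℕₚ
  open import Data.Fin as Fin using (Fin; zero; suc; toℕ; fromℕ)
  open import Data.Fin.Properties using (toℕ≤pred[n]; toℕ-fromℕ)
  open import Data.Bool using (Bool; true; false; not; _∧_; _∨_)
  open import Data.Bool.Properties using (∧-conicalˡ; ∧-conicalʳ; not-injective)
  open import Data.List using (_∷_; tabulate)
  open import Data.Vec as Vec using (Vec; _∷_; lookup)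
  open import Data.Vec.Relation.Unary.Any using (here; there)
  open import Data.Product using (_×_; _,_; proj₁; proj₂)
  open import Data.Sum using (inj₁; inj₂)
  open import Function using (_∘_)
  open import Relation.Nullary using (contradiction)
  open import Relation.Binary.PropositionalEquality
  open import Algebra.Bundles using (CommutativeRing)
  open WeightedSums using (⟦_⟧; count-partition)
  open Rearrangement using (complement)
  open FieldFacts F
  open Evaluation F
  open ProjectivePoints F
  open CommutativeRing ring using (zeroˡ; zeroʳ; *-identityʳ; +-identityˡ; +-identityʳ; *-comm; distribˡ)
  open import Algebra.Properties.Ring (CommutativeRing.ring ring)
    using (-‿distribʳ-*; -‿injective; +-cancelʳ; x∙y⁻¹≈ε⇒x≈y; x≈y⇒x∙y⁻¹≈ε)
  open import Algebra.Properties.Semiring.Sum (CommutativeRing.semiring ring) using (sum-cong-≗; *-distribˡ-sum)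
  open ≡-Reasoning

  homogenized-sum : ∀ k (H : Fin (suc k) → Carrier) a b t → b * t ≡ a →
    sum (λ i → H i * pw a (toℕ i) * pw b (k ∸ toℕ i)) ≡ pw b k * sum (λ i → H i * pw t (toℕ i))
  homogenized-sum k H a b t bt≡a =
    trans (sum-cong-≗ term) (sym (*-distribˡ-sum (pw b k) (λ i → H i * pw t (toℕ i))))
    where
    term : ∀ i → H i * pw a (toℕ i) * pw b (k ∸ toℕ i) ≡ pw b k * (H i * pw t (toℕ i))
    term i = begin
      H i * pw a (toℕ i) * pw b (k ∸ toℕ i)
        ≡⟨ cong (λ z → H i * z * pw b (k ∸ toℕ i)) (trans (cong (λ z → pw z (toℕ i)) (sym bt≡a)) (pw-* b t (toℕ i))) ⟩
      H i * (pw b (toℕ i) * pw t (toℕ i)) * pw b (k ∸ toℕ i)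
        ≡⟨ solve 4 (λ h u v w → h :* (u :* v) :* w := w :* u :* (h :* v)) refl (H i) (pw b (toℕ i)) (pw t (toℕ i)) (pw b (k ∸ toℕ i)) ⟩
      pw b (k ∸ toℕ i) * pw b (toℕ i) * (H i * pw t (toℕ i))
        ≡⟨ cong (_* (H i * pw t (toℕ i))) (sym (pw-+ b (k ∸ toℕ i) (toℕ i))) ⟩
      pw b (k ∸ toℕ i ℕ.+ toℕ i) * (H i * pw t (toℕ i))
        ≡⟨ cong (λ e → pw b e * (H i * pw t (toℕ i))) (ℕₚ.m∸n+n≡m (toℕ≤pred[n] i)) ⟩
      pw b k * (H i * pw t (toℕ i)) ∎

  top-term : ∀ k (H : Fin (suc k) → Carrier) → sum (λ i → H i * pw 0# (k ∸ toℕ i)) ≡ H (fromℕ k)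
  top-term zero    H = trans (+-identityʳ _) (*-identityʳ (H zero))
  top-term (suc k) H = begin
    H zero * (0# * pw 0# k) + sum (λ i → H (suc i) * pw 0# (k ∸ toℕ i))
      ≡⟨ cong (_+ sum (λ i → H (suc i) * pw 0# (k ∸ toℕ i))) (trans (cong (H zero *_) (zeroˡ _)) (zeroʳ _)) ⟩
    0# + sum (λ i → H (suc i) * pw 0# (k ∸ toℕ i))
      ≡⟨ +-identityˡ _ ⟩
    sum (λ i → H (suc i) * pw 0# (k ∸ toℕ i))
      ≡⟨ top-term k (H ∘ suc) ⟩
    H (suc (fromℕ k)) ∎

  -- the Boolean identities behind B = A + X and D = C + Y: zf, z₁, z₀ say
  -- whether f₁, g₁, g₀ vanish, s, s̄, ŝ whether some f_j, f̄_j, f̂_j does not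
  eliminate-split : ∀ zf s z₁ z₀ → (z₁ ≡ true → z₀ ≡ zf) →
    ⟦ not zf ∨ s ⟧ ℕ.+ ⟦ zf ∧ (not s ∧ not z₁) ⟧ ≡ ⟦ not z₁ ∨ (not z₀ ∨ s) ⟧
  eliminate-split true  true  false z₀ _ = refl
  eliminate-split true  false false z₀ _ = refl
  eliminate-split false s     false z₀ _ = refl
  eliminate-split zf    s     true  z₀ e rewrite e refl with zf | s
  ... | true  | true  = refl
  ... | true  | false = refl
  ... | false | _     = refl

  reduce-split : ∀ z₁ s̄ ŝ → (z₁ ≡ true → s̄ ≡ ŝ) →
    ⟦ s̄ ⟧ ℕ.+ ⟦ not z₁ ∧ not s̄ ⟧ ≡ ⟦ not z₁ ∨ ŝ ⟧
  reduce-split false true  ŝ _ = refl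
  reduce-split false false ŝ _ = refl
  reduce-split true  s̄     ŝ e rewrite e refl = ℕₚ.+-identityʳ ⟦ ŝ ⟧

  ∧-congˡ-true : ∀ {a b b′ : Bool} → (a ≡ true → b ≡ b′) → (a ∧ b) ≡ (a ∧ b′)
  ∧-congˡ-true {false} _ = refl
  ∧-congˡ-true {true}  e = e refl

  -- the data of part (2); points of F^n are written a ∷ y with a = x₁
  module Elimination {n′ m′ : ℕ} (g₁ g₀ : Poly n′) (f₁ : Poly (suc n′))
    (f : Fin m′ → Poly (suc n′)) (k : Fin m′ → ℕ) (h : (j : Fin m′) → Fin (suc (k j)) → Poly n′)
    (f₁-homogeneous : Homogeneous f₁) (f-homogeneous : ∀ j → Homogeneous (f j))
    (f₁-linear : f₁ ≈ₚ lift g₁ ⊗ var zero ⊝ lift g₀)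
    (f-expansion : ∀ j → f j ≈ₚ ∑ᵖ (λ i → lift (h j i) ⊗ (var zero ^ᵖ toℕ i)))
    where

    f̄ f̂ : Fin m′ → Poly n′
    f̄ j = fbar g₁ g₀ (k j) (h j)
    f̂ j = fhat g₀ (k j) (h j)

    G₁ G₀ : Vec Carrier n′ → Carrier
    G₁ y = ev y g₁
    G₀ y = ev y g₀

    d : ℕ
    d = proj₁ (homogeneous-scale {p = f₁} f₁-homogeneous)

    f₁-scale : ∀ c x → ev (scale c x) f₁ ≡ pw c d * ev x f₁
    f₁-scale = proj₂ (homogeneous-scale {p = f₁} f₁-homogeneous)

    f₁-at : ∀ a y → ev (a ∷ y) f₁ ≡ G₁ y * a + - G₀ y
    f₁-at a y = trans (f₁-linear ring _) (cong₂ (λ u v → u * a + - v) (lift-at a y g₁) (lift-at a y g₀))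

    f-at : ∀ j a y → ev (a ∷ y) (f j) ≡ sum (λ i → ev y (h j i) * pw a (toℕ i))
    f-at j a y = trans (f-expansion j ring _)
      (trans (eval-∑ (lookup (a ∷ y)) (λ i → lift (h j i) ⊗ (var zero ^ᵖ toℕ i))) (sum-cong-≗ λ i →
      cong₂ _*_ (lift-at a y (h j i)) (eval-pow (lookup (a ∷ y)) (var zero) (toℕ i))))

    fbar-at : ∀ j y → ev y (f̄ j) ≡ sum (λ i → ev y (h j i) * pw (G₀ y) (toℕ i) * pw (G₁ y) (k j ∸ toℕ i))
    fbar-at j y = trans (eval-∑ (lookup y) (λ i → h j i ⊗ (g₀ ^ᵖ toℕ i) ⊗ (g₁ ^ᵖ (k j ∸ toℕ i)))) (sum-cong-≗ λ i →
      cong₂ _*_ (cong (ev y (h j i) *_) (eval-pow (lookup y) g₀ (toℕ i))) (eval-pow (lookup y) g₁ (k j ∸ toℕ i)))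

    ratio : Vec Carrier n′ → Carrier
    ratio y = G₀ y * inv (G₁ y)

    ext : Vec Carrier n′ → Vec Carrier (suc n′)
    ext y = ratio y ∷ y

    G₁-ratio : ∀ y → G₁ y ≢ 0# → G₁ y * ratio y ≡ G₀ y
    G₁-ratio y g≢0 = begin
      G₁ y * (G₀ y * inv (G₁ y)) ≡⟨ solve 3 (λ g a i → g :* (a :* i) := a :* (g :* i)) refl (G₁ y) (G₀ y) (inv (G₁ y)) ⟩
      G₀ y * (G₁ y * inv (G₁ y)) ≡⟨ cong (G₀ y *_) (inv-r g≢0) ⟩
      G₀ y * 1#                  ≡⟨ *-identityʳ _ ⟩
      G₀ y                       ∎

    ext-root : ∀ y → G₁ y ≢ 0# → ev (ext y) f₁ ≡ 0#
    ext-root y g≢0 = trans (f₁-at (ratio y) y) (x≈y⇒x∙y⁻¹≈ε (G₁-ratio y g≢0))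

    root-unique : ∀ {a} y → G₁ y ≢ 0# → ev (a ∷ y) f₁ ≡ 0# → a ≡ ratio y
    root-unique {a} y g≢0 f₁≡0 = solve-for g≢0 (x∙y⁻¹≈ε⇒x≈y _ _ (trans (sym (f₁-at a y)) f₁≡0))

    -- homogeneity of f₁ = g₁x₁ - g₀ forces g₀(cy) = c^d g₀(y) and c g₁(cy) = c^d g₁(y)
    scaled-line : ∀ c a y → G₁ (scale c y) * (c * a) + - G₀ (scale c y) ≡ pw c d * (G₁ y * a + - G₀ y)
    scaled-line c a y = trans (sym (f₁-at (c * a) (scale c y))) (trans (f₁-scale c (a ∷ y)) (cong (pw c d *_) (f₁-at a y)))

    G₀-scale : ∀ c y → G₀ (scale c y) ≡ pw c d * G₀ y
    G₀-scale c y = -‿injective (begin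
      - G₀ (scale c y)                               ≡⟨ sym (at-zero (G₁ (scale c y)) _) ⟩
      G₁ (scale c y) * 0# + - G₀ (scale c y)         ≡⟨ cong (λ z → G₁ (scale c y) * z + - G₀ (scale c y)) (sym (zeroʳ c)) ⟩
      G₁ (scale c y) * (c * 0#) + - G₀ (scale c y)   ≡⟨ scaled-line c 0# y ⟩
      pw c d * (G₁ y * 0# + - G₀ y)                  ≡⟨ cong (pw c d *_) (at-zero (G₁ y) (G₀ y)) ⟩
      pw c d * - G₀ y                                ≡⟨ sym (-‿distribʳ-* _ _) ⟩
      - (pw c d * G₀ y)                              ∎)
      where
      at-zero : ∀ u v → u * 0# + - v ≡ - v
      at-zero u v = trans (cong (_+ - v) (zeroʳ u)) (+-identityˡ (- v))

    G₁-scale : ∀ c y → c * G₁ (scale c y) ≡ pw c d * G₁ y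
    G₁-scale c y = +-cancelʳ (- G₀ (scale c y)) _ _ (begin
      c * G₁ (scale c y) + - G₀ (scale c y)         ≡⟨ cong (_+ - G₀ (scale c y)) (trans (*-comm c _) (cong (G₁ (scale c y) *_) (sym (*-identityʳ c)))) ⟩
      G₁ (scale c y) * (c * 1#) + - G₀ (scale c y) ≡⟨ scaled-line c 1# y ⟩
      pw c d * (G₁ y * 1# + - G₀ y)                ≡⟨ distribˡ (pw c d) _ _ ⟩
      pw c d * (G₁ y * 1#) + pw c d * - G₀ y       ≡⟨ cong₂ _+_ (cong (pw c d *_) (*-identityʳ _)) (sym (-‿distribʳ-* _ _)) ⟩
      pw c d * G₁ y + - (pw c d * G₀ y)            ≡⟨ cong (λ z → pw c d * G₁ y + - z) (sym (G₀-scale c y)) ⟩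
      pw c d * G₁ y + - G₀ (scale c y)             ∎)

    isZero-G₁-invariant : ∀ {c} y → c ≢ 0# → isZero (G₁ (scale c y)) ≡ isZero (G₁ y)
    isZero-G₁-invariant {c} y c≢0 = begin
      isZero (G₁ (scale c y))     ≡⟨ sym (isZero-unitˡ _ c≢0) ⟩
      isZero (c * G₁ (scale c y)) ≡⟨ cong isZero (G₁-scale c y) ⟩
      isZero (pw c d * G₁ y)      ≡⟨ isZero-unitˡ _ (pw-≢0 d c≢0) ⟩
      isZero (G₁ y)               ∎

    G₁-≢0-invariant : ∀ {c} y → c ≢ 0# → G₁ y ≢ 0# → G₁ (scale c y) ≢ 0#
    G₁-≢0-invariant y c≢0 g≢0 = isZero-≢0 (trans (isZero-G₁-invariant y c≢0) (≢0-isZero g≢0))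

    ext-equivariant : ∀ {c} y → c ≢ 0# → G₁ y ≢ 0# → ext (scale c y) ≡ scale c (ext y)
    ext-equivariant {c} y c≢0 g≢0 = cong (_∷ scale c y) (sym (root-unique (scale c y) (G₁-≢0-invariant y c≢0 g≢0) (begin
      ev (scale c (ext y)) f₁ ≡⟨ f₁-scale c (ext y) ⟩
      pw c d * ev (ext y) f₁  ≡⟨ cong (pw c d *_) (ext-root y g≢0) ⟩
      pw c d * 0#             ≡⟨ zeroʳ _ ⟩
      0#                      ∎)))

    fbar-ext : ∀ j y → G₁ y ≢ 0# → ev y (f̄ j) ≡ pw (G₁ y) (k j) * ev (ext y) (f j)
    fbar-ext j y g≢0 = trans (fbar-at j y)
      (trans (homogenized-sum (k j) (λ i → ev y (h j i)) (G₀ y) (G₁ y) (ratio y) (G₁-ratio y g≢0))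
             (cong (pw (G₁ y) (k j) *_) (sym (f-at j (ratio y) y))))

    isZero-fbar : ∀ j y → G₁ y ≢ 0# → isZero (ev y (f̄ j)) ≡ isZero (ev (ext y) (f j))
    isZero-fbar j y g≢0 = trans (cong isZero (fbar-ext j y g≢0)) (isZero-unitˡ _ (pw-≢0 (k j) g≢0))

    -- on g₁ = 0, f̄_j = h_{j,k_j} g₀^{k_j}, which vanishes exactly where f̂_j does
    isZero-fbar-fhat : ∀ j y → G₁ y ≡ 0# → isZero (ev y (f̄ j)) ≡ isZero (ev y (f̂ j))
    isZero-fbar-fhat j y g≡0 = trans (cong isZero top) (by-degree (k j) (h j))
      where
      top : ev y (f̄ j) ≡ ev y (h j (fromℕ (k j))) * pw (G₀ y) (k j)
      top = begin
        ev y (f̄ j)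
          ≡⟨ fbar-at j y ⟩
        sum (λ i → ev y (h j i) * pw (G₀ y) (toℕ i) * pw (G₁ y) (k j ∸ toℕ i))
          ≡⟨ sum-cong-≗ (λ i → cong (λ z → ev y (h j i) * pw (G₀ y) (toℕ i) * pw z (k j ∸ toℕ i)) g≡0) ⟩
        sum (λ i → ev y (h j i) * pw (G₀ y) (toℕ i) * pw 0# (k j ∸ toℕ i))
          ≡⟨ top-term (k j) (λ i → ev y (h j i) * pw (G₀ y) (toℕ i)) ⟩
        ev y (h j (fromℕ (k j))) * pw (G₀ y) (toℕ (fromℕ (k j)))
          ≡⟨ cong (λ e → ev y (h j (fromℕ (k j))) * pw (G₀ y) e) (toℕ-fromℕ (k j)) ⟩
        ev y (h j (fromℕ (k j))) * pw (G₀ y) (k j) ∎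
      by-degree : ∀ K (H : Fin (suc K) → Poly n′) →
        isZero (ev y (H (fromℕ K)) * pw (G₀ y) K) ≡ isZero (ev y (fhat g₀ K H))
      by-degree zero    H = cong isZero (*-identityʳ _)
      by-degree (suc K) H = begin
        isZero (ev y (H (fromℕ (suc K))) * pw (G₀ y) (suc K))     ≡⟨ isZero-* _ _ ⟩
        isZero (ev y (H (fromℕ (suc K)))) ∨ isZero (pw (G₀ y) (suc K)) ≡⟨ cong (isZero (ev y (H (fromℕ (suc K)))) ∨_) (isZero-pw (G₀ y) K) ⟩
        isZero (ev y (H (fromℕ (suc K)))) ∨ isZero (G₀ y)        ≡⟨ sym (isZero-* _ _) ⟩
        isZero (ev y (H (fromℕ (suc K))) * G₀ y)                 ∎

    f̄-zeros : ∀ y → G₁ y ≢ 0# → someNonzero (tabulate f̄) y ≡ someNonzero (tabulate f) (ext y)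
    f̄-zeros y g≢0 = someNonzero-cong f̄ f y (ext y) (λ j → isZero-fbar j y g≢0)

    isX : Vec Carrier (suc n′) → Bool
    isX x = isZero (ev x f₁) ∧ (not (someNonzero (tabulate f) x) ∧ not (isZero (ev x (lift g₁))))

    isY : Vec Carrier n′ → Bool
    isY y = not (isZero (G₁ y)) ∧ not (someNonzero (tabulate f̄) y)

    isX-parts : ∀ a y → isX (a ∷ y) ≡ true →
      ev (a ∷ y) f₁ ≡ 0# × someNonzero (tabulate f) (a ∷ y) ≡ false × G₁ y ≢ 0#
    isX-parts a y e =
      isZero-≡0 (∧-conicalˡ _ _ e) ,
      not-injective (∧-conicalˡ _ _ rest) ,
      (λ g≡0 → isZero-≢0 (not-injective (∧-conicalʳ _ _ rest)) (trans (lift-at a y g₁) g≡0))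
      where rest = ∧-conicalʳ (isZero (ev (a ∷ y) f₁)) _ e

    isX-intro : ∀ a y → ev (a ∷ y) f₁ ≡ 0# → someNonzero (tabulate f) (a ∷ y) ≡ false → G₁ y ≢ 0# →
      isX (a ∷ y) ≡ true
    isX-intro a y f₁≡0 f≡0 g≢0 = cong₂ _∧_ (≡0-isZero f₁≡0)
      (cong₂ _∧_ (cong not f≡0) (cong not (trans (cong isZero (lift-at a y g₁)) (≢0-isZero g≢0))))

    isY-parts : ∀ y → isY y ≡ true → G₁ y ≢ 0# × someNonzero (tabulate f̄) y ≡ false
    isY-parts y e = isZero-≢0 (not-injective (∧-conicalˡ _ _ e)) , not-injective (∧-conicalʳ _ _ e)

    X→Y : ∀ x → isX x ≡ true → isY (Vec.tail x) ≡ true × ext (Vec.tail x) ≡ x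
    X→Y (a ∷ y) e with isX-parts a y e
    ... | f₁≡0 , f≡0 , g≢0 =
      cong₂ _∧_ (cong not (≢0-isZero g≢0))
                (cong not (trans (f̄-zeros y g≢0) (trans (cong (someNonzero (tabulate f)) ext≡x) f≡0))) ,
      ext≡x
      where
      ext≡x : ext y ≡ a ∷ y
      ext≡x = cong (_∷ y) (sym (root-unique y g≢0 f₁≡0))

    Y→X : ∀ y → isY y ≡ true → isX (ext y) ≡ true × Vec.tail (ext y) ≡ y
    Y→X y e with isY-parts y e
    ... | g≢0 , f̄≡0 = isX-intro (ratio y) y (ext-root y g≢0) (trans (sym (f̄-zeros y g≢0)) f̄≡0) g≢0 , refl

    isX-invariant : ∀ {c} x → c ≢ 0# → isX (scale c x) ≡ isX x
    isX-invariant {c} (a ∷ y) c≢0 = cong₂ _∧_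
      (homogeneous-zero-invariant {p = f₁} f₁-homogeneous (a ∷ y) c≢0)
      (cong₂ (λ u v → not u ∧ not v)
        (someNonzero-cong f f (scale c (a ∷ y)) (a ∷ y) (λ j → homogeneous-zero-invariant {p = f j} (f-homogeneous j) (a ∷ y) c≢0))
        (trans (cong isZero (lift-at (c * a) (scale c y) g₁))
               (trans (isZero-G₁-invariant y c≢0) (sym (cong isZero (lift-at a y g₁))))))

    isY-invariant : ∀ {c} y → c ≢ 0# → isY (scale c y) ≡ isY y
    isY-invariant {c} y c≢0 =
      trans (cong (λ z → not z ∧ not (someNonzero (tabulate f̄) (scale c y))) (isZero-G₁-invariant y c≢0))
            (∧-congˡ-true (λ g≢0 → cong not (f̄-zeros-invariant (isZero-≢0 (not-injective g≢0)))))
      where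
      f̄-zeros-invariant : G₁ y ≢ 0# → someNonzero (tabulate f̄) (scale c y) ≡ someNonzero (tabulate f̄) y
      f̄-zeros-invariant g≢0 = someNonzero-cong f̄ f̄ (scale c y) y λ j → begin
        isZero (ev (scale c y) (f̄ j))       ≡⟨ isZero-fbar j (scale c y) (G₁-≢0-invariant y c≢0 g≢0) ⟩
        isZero (ev (ext (scale c y)) (f j)) ≡⟨ cong (λ z → isZero (ev z (f j))) (ext-equivariant y c≢0 g≢0) ⟩
        isZero (ev (scale c (ext y)) (f j)) ≡⟨ homogeneous-zero-invariant {p = f j} (f-homogeneous j) (ext y) c≢0 ⟩
        isZero (ev (ext y) (f j))           ≡⟨ sym (isZero-fbar j y g≢0) ⟩
        isZero (ev y (f̄ j))                 ∎

    tail-scale : ∀ c (x : Vec Carrier (suc n′)) → Vec.tail (scale c x) ≡ scale c (Vec.tail x)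
    tail-scale c (a ∷ y) = refl

    -- a representative x with isX x has nonzero tail: otherwise both x₁ and
    -- 0 would be roots of f₁(·, 0), which has a single root as g₁(0) ≠ 0
    tail-nonzero : ∀ x → isProjRep x ≡ true → isX x ≡ true → NonZeroVec (Vec.tail x)
    tail-nonzero (a ∷ y) rep e with rep-nonzero (a ∷ y) rep | isX-parts a y e
    ... | there nz  | _ = nz
    ... | here a≢0 | f₁≡0 , _ , g≢0 with zero-or-nonzero y
    ...   | inj₁ nz   = nz
    ...   | inj₂ 0y≡y = contradiction (trans (root-unique y g≢0 f₁≡0) (sym (root-unique y g≢0 f₁-at-0))) a≢0
      where
      f₁-at-0 : ev (0# ∷ y) f₁ ≡ 0#
      f₁-at-0 = begin
        ev (0# ∷ y) f₁           ≡⟨ cong (λ v → ev v f₁) (sym (cong₂ _∷_ (zeroˡ a) 0y≡y)) ⟩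
        ev (scale 0# (a ∷ y)) f₁ ≡⟨ f₁-scale 0# (a ∷ y) ⟩
        pw 0# d * ev (a ∷ y) f₁  ≡⟨ cong (pw 0# d *_) f₁≡0 ⟩
        pw 0# d * 0#             ≡⟨ zeroʳ _ ⟩
        0#                       ∎

    X≡Y : count (λ x → isProjRep x ∧ isX x) (allVecs q (suc n′)) ≡ count (λ y → isProjRep y ∧ isY y) (allVecs q n′)
    X≡Y = projective-bijection isX isY Vec.tail ext isX-invariant isY-invariant
      (λ x _ _ → tail-scale _ x) (λ y c≢0 e → ext-equivariant y c≢0 (proj₁ (isY-parts y e)))
      tail-nonzero (λ y rep _ → there (rep-nonzero y rep)) X→Y Y→X

    -- where g₁ vanishes, f₁ = -g₀
    g₁-vanishes : ∀ x → isZero (ev x (lift g₁)) ≡ true → isZero (ev x (lift g₀)) ≡ isZero (ev x f₁)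
    g₁-vanishes x z = sym (begin
      isZero (ev x f₁)                                          ≡⟨ cong isZero (f₁-linear ring (lookup x)) ⟩
      isZero (ev x (lift g₁) * lookup x zero + - ev x (lift g₀)) ≡⟨ cong (λ u → isZero (u * lookup x zero + - ev x (lift g₀))) (isZero-≡0 z) ⟩
      isZero (0# * lookup x zero + - ev x (lift g₀))            ≡⟨ cong isZero (trans (cong (_+ - ev x (lift g₀)) (zeroˡ _)) (+-identityˡ _)) ⟩
      isZero (- ev x (lift g₀))                                 ≡⟨ isZero-neg _ ⟩
      isZero (ev x (lift g₀))                                   ∎)

    split-B : N̄ℙ (f₁ ∷ tabulate f) ℕ.+ count (λ x → isProjRep x ∧ isX x) (allVecs q (suc n′))
                ≡ N̄ℙ (lift g₁ ∷ lift g₀ ∷ tabulate f)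
    split-B = count-partition (inℙ (f₁ ∷ tabulate f)) _ (inℙ (lift g₁ ∷ lift g₀ ∷ tabulate f)) (allVecs q (suc n′)) pointwise
      where
      pointwise : ∀ x → ⟦ inℙ (f₁ ∷ tabulate f) x ⟧ ℕ.+ ⟦ isProjRep x ∧ isX x ⟧
                          ≡ ⟦ inℙ (lift g₁ ∷ lift g₀ ∷ tabulate f) x ⟧
      pointwise x with isProjRep x
      ... | false = refl
      ... | true  = eliminate-split (isZero (ev x f₁)) (someNonzero (tabulate f) x)
                      (isZero (ev x (lift g₁))) (isZero (ev x (lift g₀))) (g₁-vanishes x)

    split-D : N̄ℙ (tabulate f̄) ℕ.+ count (λ y → isProjRep y ∧ isY y) (allVecs q n′) ≡ N̄ℙ (g₁ ∷ tabulate f̂)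
    split-D = count-partition (inℙ (tabulate f̄)) _ (inℙ (g₁ ∷ tabulate f̂)) (allVecs q n′) pointwise
      where
      pointwise : ∀ y → ⟦ inℙ (tabulate f̄) y ⟧ ℕ.+ ⟦ isProjRep y ∧ isY y ⟧ ≡ ⟦ inℙ (g₁ ∷ tabulate f̂) y ⟧
      pointwise y with isProjRep y
      ... | false = refl
      ... | true  = reduce-split (isZero (G₁ y)) (someNonzero (tabulate f̄) y) (someNonzero (tabulate f̂) y)
                      (λ z → someNonzero-cong f̄ f̂ y y (λ j → isZero-fbar-fhat j y (isZero-≡0 z)))

    part2 : N̄ℙ (f₁ ∷ tabulate f) ℕ.+ N̄ℙ (g₁ ∷ tabulate f̂) ≡ N̄ℙ (lift g₁ ∷ lift g₀ ∷ tabulate f) ℕ.+ N̄ℙ (tabulate f̄)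
    part2 = complement _ _ _ _ _ split-B (trans (cong (N̄ℙ (tabulate f̄) ℕ.+_) X≡Y) split-D)

-- Part (3): off the hypersurface gh = 0 the substitution σ : x_i ↦ x_i g/h
-- (i ∈ I) is a bijection with inverse τ : x_i ↦ x_i h/g, since g and h do
-- not involve the x_i; and f(σ x) = f̃(x) g^k h^{-ℓ} with g, h invertible,
-- so σ carries the common zeros of f̃ onto those of f.
module PartThree {q : ℕ} (F : FiniteField q) where
  open import Data.Nat as ℕ using (suc)
  open import Data.Integer as ℤ using (ℤ; +_; -[1+_])
  open import Data.Fin as Fin using (Fin)
  open import Data.Fin.Subset using (Subset; inside; outside)
  open import Data.Bool using (Bool; true; false; not; _∧_)
  open import Data.Bool.Properties using (∧-conicalˡ; not-injective)
  open import Data.List using (List; _∷_; tabulate)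
  open import Data.Vec as Vec using (Vec; lookup)
  open import Data.Vec.Properties using (lookup∘tabulate; tabulate∘lookup; tabulate-cong; ≡-dec)
  open import Data.Product using (_×_; _,_)
  open import Data.Sum using (_⊎_; inj₁; inj₂)
  open import Relation.Binary.PropositionalEquality
  open WeightedSums using (⟦_⟧; count-partition)
  open Rearrangement using (complement)
  open DoubleCounting using (count-bijection; allVecs-enumerates)
  open FieldFacts F
  open Evaluation F
  open import Algebra.Bundles using (CommutativeRing)
  open CommutativeRing ring using (zeroˡ; zeroʳ; *-identityʳ; *-comm)
  open ≡-Reasoning

  affine-split : ∀ {n} (p : Poly n) (fs : List (Poly n)) →
    N̄𝔸 fs ℕ.+ count (λ x → not (isZero (ev x p)) ∧ not (someNonzero fs x)) (allVecs q n)
      ≡ N̄𝔸 (p ∷ fs)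
  affine-split {n} p fs = count-partition _ _ _ (allVecs q n) pointwise
    where
    pointwise : ∀ x → ⟦ someNonzero fs x ⟧ ℕ.+ ⟦ not (isZero (ev x p)) ∧ not (someNonzero fs x) ⟧
                        ≡ ⟦ someNonzero (p ∷ fs) x ⟧
    pointwise x with someNonzero fs x | isZero (ev x p)
    ... | true  | true  = refl
    ... | true  | false = refl
    ... | false | true  = refl
    ... | false | false = refl

  substPt-avoids : ∀ {n} (I : Subset n) a b (ρ : Fin n → Carrier) {p} → Avoids I p →
    eval ring (substPt ring I a b ρ) p ≡ eval ring ρ p
  substPt-avoids I a b ρ (acon z) = refl
  substPt-avoids I a b ρ (avar i i∉I) with lookup I i
  substPt-avoids I a b ρ (avar i refl) | .outside = refl
  substPt-avoids I a b ρ (aadd p q) = cong₂ _+_ (substPt-avoids I a b ρ p) (substPt-avoids I a b ρ q)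
  substPt-avoids I a b ρ (amul p q) = cong₂ _*_ (substPt-avoids I a b ρ p) (substPt-avoids I a b ρ q)
  substPt-avoids I a b ρ (aneg p)   = cong -_ (substPt-avoids I a b ρ p)

  substPt-fixes : ∀ {n} (I : Subset n) (g : Poly n) → InVarsOutside I g →
    ∀ a b (ρ : Fin n → Carrier) → eval ring (substPt ring I a b ρ) g ≡ eval ring ρ g
  substPt-fixes I g (g′ , g≈g′ , avoids) a b ρ =
    trans (g≈g′ ring _) (trans (substPt-avoids I a b ρ avoids) (sym (g≈g′ ring ρ)))

  substPt-cong : ∀ {n} (I : Subset n) a b {ρ ρ′ : Fin n → Carrier} i →
    ρ i ≡ ρ′ i → substPt ring I a b ρ i ≡ substPt ring I a b ρ′ i
  substPt-cong I a b i e with lookup I i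
  ... | inside  = cong (λ z → z * a * b) e
  ... | outside = e

  side : ∀ {n} (I : Subset n) i → lookup I i ≡ inside ⊎ lookup I i ≡ outside
  side I i with lookup I i
  ... | inside  = inj₁ refl
  ... | outside = inj₂ refl

  substPt-outside : ∀ {n} (I : Subset n) a b (ρ : Fin n → Carrier) i →
    lookup I i ≡ outside → substPt ring I a b ρ i ≡ ρ i
  substPt-outside I a b ρ i i∉I with lookup I i
  ... | outside = refl

  substPt-inside : ∀ {n} (I : Subset n) a b (ρ : Fin n → Carrier) i →
    lookup I i ≡ inside → substPt ring I a b ρ i ≡ ρ i * a * b
  substPt-inside I a b ρ i i∈I with lookup I i
  ... | inside = refl

  substPt-inverse : ∀ {n} (I : Subset n) a b c d (ρ : Fin n → Carrier) i →
    c * b ≡ 1# → d * a ≡ 1# → substPt ring I a b (substPt ring I c d ρ) i ≡ ρ i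
  substPt-inverse I a b c d ρ i cb≡1 da≡1 with side I i
  ... | inj₂ e = trans (substPt-outside I a b _ i e) (substPt-outside I c d ρ i e)
  ... | inj₁ e = begin
    substPt ring I a b (substPt ring I c d ρ) i ≡⟨ substPt-inside I a b _ i e ⟩
    substPt ring I c d ρ i * a * b              ≡⟨ cong (λ z → z * a * b) (substPt-inside I c d ρ i e) ⟩
    ρ i * c * d * a * b     ≡⟨ solve 5 (λ r c d a b → r :* c :* d :* a :* b := r :* (c :* b) :* (d :* a)) refl (ρ i) c d a b ⟩
    ρ i * (c * b) * (d * a) ≡⟨ cong₂ (λ u v → ρ i * u * v) cb≡1 da≡1 ⟩
    ρ i * 1# * 1#           ≡⟨ trans (*-identityʳ _) (*-identityʳ _) ⟩
    ρ i                     ∎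

  powℤ-≢0 : ∀ {a a⁻¹} k → a * a⁻¹ ≡ 1# → powℤ ring a a⁻¹ k ≢ 0#
  powℤ-≢0 (+ k)    aa⁻¹≡1 = pw-≢0 k (invertible-≢0 aa⁻¹≡1)
  powℤ-≢0 -[1+ k ] aa⁻¹≡1 = pw-≢0 (suc k) (invertible-≢0 (trans (*-comm _ _) aa⁻¹≡1))

  -- the data of part (3); the transformation law is only needed over F
  module Substitution {n m : ℕ} (I : Subset n) (g h : Poly n) (f f̃ : Fin m → Poly n) (k ℓ : ℤ)
    (g-outside : InVarsOutside I g) (h-outside : InVarsOutside I h)
    (transforms : ∀ ρ gi hi → eval ring ρ g * gi ≡ 1# → eval ring ρ h * hi ≡ 1# → ∀ j →
       eval ring (substPt ring I (eval ring ρ g) hi ρ) (f j)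
         ≡ eval ring ρ (f̃ j) * powℤ ring (eval ring ρ g) gi k * powℤ ring (eval ring ρ h) hi (ℤ.- ℓ))
    where

    G H : Vec Carrier n → Carrier
    G x = ev x g
    H x = ev x h

    subst-at : Carrier → Carrier → Vec Carrier n → Vec Carrier n
    subst-at a b x = Vec.tabulate (substPt ring I a b (lookup x))

    σ τ : Vec Carrier n → Vec Carrier n
    σ x = subst-at (G x) (inv (H x)) x
    τ x = subst-at (H x) (inv (G x)) x

    subst-fixes : ∀ (p : Poly n) → InVarsOutside I p → ∀ a b x → ev (subst-at a b x) p ≡ ev x p
    subst-fixes p p-outside a b x =
      trans (eval-cong (lookup∘tabulate _) p) (substPt-fixes I p p-outside a b (lookup x))

    subst-undo : ∀ a b c d x → c * b ≡ 1# → d * a ≡ 1# → subst-at a b (subst-at c d x) ≡ x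
    subst-undo a b c d x cb≡1 da≡1 = trans
      (tabulate-cong (λ i → trans (substPt-cong I a b i (lookup∘tabulate _ i))
                                  (substPt-inverse I a b c d (lookup x) i cb≡1 da≡1)))
      (tabulate∘lookup x)

    τ∘σ : ∀ x → G x ≢ 0# → H x ≢ 0# → τ (σ x) ≡ x
    τ∘σ x g≢0 h≢0 = begin
      subst-at (H (σ x)) (inv (G (σ x))) (σ x)
        ≡⟨ cong₂ (λ a b → subst-at a (inv b) (σ x)) (subst-fixes h h-outside _ _ x) (subst-fixes g g-outside _ _ x) ⟩
      subst-at (H x) (inv (G x)) (σ x)
        ≡⟨ subst-undo _ _ _ _ x (inv-r g≢0) (inv-l h≢0) ⟩
      x ∎

    σ∘τ : ∀ x → G x ≢ 0# → H x ≢ 0# → σ (τ x) ≡ x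
    σ∘τ x g≢0 h≢0 = begin
      subst-at (G (τ x)) (inv (H (τ x))) (τ x)
        ≡⟨ cong₂ (λ a b → subst-at a (inv b) (τ x)) (subst-fixes g g-outside _ _ x) (subst-fixes h h-outside _ _ x) ⟩
      subst-at (G x) (inv (H x)) (τ x)
        ≡⟨ subst-undo _ _ _ _ x (inv-r h≢0) (inv-l g≢0) ⟩
      x ∎

    isZero-f∘σ : ∀ x → G x ≢ 0# → H x ≢ 0# → ∀ j → isZero (ev (σ x) (f j)) ≡ isZero (ev x (f̃ j))
    isZero-f∘σ x g≢0 h≢0 j = begin
      isZero (ev (σ x) (f j))
        ≡⟨ cong isZero (trans (eval-cong (lookup∘tabulate _) (f j))
                              (transforms (lookup x) _ _ (inv-r g≢0) (inv-r h≢0) j)) ⟩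
      isZero (ev x (f̃ j) * powℤ ring (G x) (inv (G x)) k * powℤ ring (H x) (inv (H x)) (ℤ.- ℓ))
        ≡⟨ isZero-unitʳ _ (powℤ-≢0 (ℤ.- ℓ) (inv-r h≢0)) ⟩
      isZero (ev x (f̃ j) * powℤ ring (G x) (inv (G x)) k)
        ≡⟨ isZero-unitʳ _ (powℤ-≢0 k (inv-r g≢0)) ⟩
      isZero (ev x (f̃ j)) ∎

    off-gh-zeros : (Fin m → Poly n) → Vec Carrier n → Bool
    off-gh-zeros fs x = not (isZero (ev x (g ⊗ h))) ∧ not (someNonzero (tabulate fs) x)

    gh-factors : ∀ x → not (isZero (ev x (g ⊗ h))) ≡ true → G x ≢ 0# × H x ≢ 0#
    gh-factors x gh≢0 = (λ g≡0 → gh≢0′ (trans (cong (_* H x) g≡0) (zeroˡ _)))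
                      , (λ h≡0 → gh≢0′ (trans (cong (G x *_) h≡0) (zeroʳ _)))
      where gh≢0′ = isZero-≢0 (not-injective gh≢0)

    σ-transports : ∀ x → G x ≢ 0# → H x ≢ 0# → off-gh-zeros f (σ x) ≡ off-gh-zeros f̃ x
    σ-transports x g≢0 h≢0 = cong₂ (λ u v → not (isZero u) ∧ not v)
      (cong₂ _*_ (subst-fixes g g-outside _ _ x) (subst-fixes h h-outside _ _ x))
      (someNonzero-cong f f̃ (σ x) x (isZero-f∘σ x g≢0 h≢0))

    zeros-bijection : count (off-gh-zeros f̃) (allVecs q n) ≡ count (off-gh-zeros f) (allVecs q n)
    zeros-bijection = count-bijection (≡-dec Fin._≟_) (≡-dec Fin._≟_) (off-gh-zeros f̃) (off-gh-zeros f) σ τ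
      forward backward (allVecs q n) (allVecs q n) (allVecs-enumerates q n) (allVecs-enumerates q n)
      where
      forward : ∀ x → off-gh-zeros f̃ x ≡ true → off-gh-zeros f (σ x) ≡ true × τ (σ x) ≡ x
      forward x zx with gh-factors x (∧-conicalˡ _ _ zx)
      ... | g≢0 , h≢0 = trans (σ-transports x g≢0 h≢0) zx , τ∘σ x g≢0 h≢0
      backward : ∀ y → off-gh-zeros f y ≡ true → off-gh-zeros f̃ (τ y) ≡ true × σ (τ y) ≡ y
      backward y zy with gh-factors y (∧-conicalˡ _ _ zy)
      ... | g≢0 , h≢0 = trans (sym (σ-transports (τ y) g≢0′ h≢0′)) (trans (cong (off-gh-zeros f) στy≡y) zy)
                      , στy≡y
        where
        στy≡y = σ∘τ y g≢0 h≢0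
        g≢0′ = λ e → g≢0 (trans (sym (subst-fixes g g-outside _ _ y)) e)
        h≢0′ = λ e → h≢0 (trans (sym (subst-fixes h h-outside _ _ y)) e)

    part3 : N̄𝔸 (tabulate f) ℕ.+ N̄𝔸 (g ⊗ h ∷ tabulate f̃) ≡ N̄𝔸 (g ⊗ h ∷ tabulate f) ℕ.+ N̄𝔸 (tabulate f̃)
    part3 = complement _ _ _ _ (count (off-gh-zeros f) (allVecs q n))
      (affine-split (g ⊗ h) (tabulate f))
      (trans (cong (N̄𝔸 (tabulate f̃) ℕ.+_) (sym zeros-bijection)) (affine-split (g ⊗ h) (tabulate f̃)))

open import Level using (0ℓ)
open import Data.Nat using (ℕ; suc)
open import Data.Integer using (ℤ; +_; _+_; _-_; -_)
open import Data.Fin using (Fin; zero; toℕ; fromℕ)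
open import Data.Fin.Subset using (Subset)
open import Data.List using (List; _∷_; tabulate)
open import Data.List.Relation.Unary.All using (All)
open import Data.Product using (_×_; _,_)
open import Data.Sum using (_⊎_)
open import Relation.Nullary using (¬_)
open import Relation.Binary.PropositionalEquality using (_≡_)
open import Algebra.Bundles using (CommutativeRing)
open Rearrangement using (exchange-ℤ)

-- Each part is an identity A + D = B + C between point counts, read in ℤ.
proposition1 : ∀ {q : ℕ} (F : FiniteField q) → let open Counting F in
    -- (1)
    (∀ {n : ℕ} (f₁ f₂ : Poly n) (fs : List (Poly n)) →
       All Homogeneous (f₁ ∷ f₂ ∷ fs) →
       + N̄ℙ (f₁ ⊗ f₂ ∷ fs)
         ≡ + N̄ℙ (f₁ ∷ fs) + + N̄ℙ (f₂ ∷ fs) - + N̄ℙ (f₁ ∷ f₂ ∷ fs))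
    ×
    -- (2)  (n = suc n′ variables x₁ = var zero, x₂..xₙ = lift of Poly n′)
    (∀ {n′ m′ : ℕ} (g₁ g₀ : Poly n′) (f₁ : Poly (suc n′))
       (f : Fin m′ → Poly (suc n′)) (k : Fin m′ → ℕ)
       (h : (j : Fin m′) → Fin (suc (k j)) → Poly n′) →
       Homogeneous f₁ → (∀ j → Homogeneous (f j)) →
       f₁ ≈ₚ lift g₁ ⊗ var zero ⊝ lift g₀ →
       (∀ j → f j ≈ₚ ∑ᵖ (λ i → lift (h j i) ⊗ (var zero ^ᵖ toℕ i))) →
       (∀ j → k j ≡ 0 ⊎ ¬ (h j (fromℕ (k j)) ≈ₚ con (+ 0))) →
       + N̄ℙ (f₁ ∷ tabulate f)
         ≡ + N̄ℙ (lift g₁ ∷ lift g₀ ∷ tabulate f)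
           + + N̄ℙ (tabulate (λ j → fbar g₁ g₀ (k j) (h j)))
           - + N̄ℙ (g₁ ∷ tabulate (λ j → fhat g₀ (k j) (h j))))
    ×
    -- (3)
    (∀ {n m : ℕ} (I : Subset n) (g h : Poly n) (f f̃ : Fin m → Poly n) (k ℓ : ℤ) →
       (∀ j → Homogeneous (f j)) →
       InVarsOutside I g → InVarsOutside I h →
       (∀ (R : CommutativeRing 0ℓ 0ℓ) ρ (gi hi : CommutativeRing.Carrier R) →
          CommutativeRing._≈_ R (CommutativeRing._*_ R (eval R ρ g) gi) (CommutativeRing.1# R) →
          CommutativeRing._≈_ R (CommutativeRing._*_ R (eval R ρ h) hi) (CommutativeRing.1# R) →
          ∀ j → CommutativeRing._≈_ R
            (eval R (substPt R I (eval R ρ g) hi ρ) (f j))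
            (CommutativeRing._*_ R
              (CommutativeRing._*_ R (eval R ρ (f̃ j)) (powℤ R (eval R ρ g) gi k))
              (powℤ R (eval R ρ h) hi (- ℓ)))) →
       + N̄𝔸 (tabulate f)
         ≡ + N̄𝔸 (g ⊗ h ∷ tabulate f) + + N̄𝔸 (tabulate f̃) - + N̄𝔸 (g ⊗ h ∷ tabulate f̃))
proposition1 F = let open Counting F in
  (λ f₁ f₂ fs _ → exchange-ℤ _ (N̄ℙ (f₁ ∷ fs)) (N̄ℙ (f₂ ∷ fs)) _ (PartOne.part1 F f₁ f₂ fs)) ,
  (λ g₁ g₀ f₁ f k h f₁-homogeneous f-homogeneous f₁-linear f-expansion _ →
     exchange-ℤ _ (N̄ℙ (lift g₁ ∷ lift g₀ ∷ tabulate f)) (N̄ℙ (tabulate (λ j → fbar g₁ g₀ (k j) (h j)))) _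
       (PartTwo.Elimination.part2 F g₁ g₀ f₁ f k h f₁-homogeneous f-homogeneous f₁-linear f-expansion)) ,
  (λ I g h f f̃ k ℓ _ g-outside h-outside transforms →
     exchange-ℤ _ (N̄𝔸 (g ⊗ h ∷ tabulate f)) (N̄𝔸 (tabulate f̃)) _
       (PartThree.Substitution.part3 F I g h f f̃ k ℓ g-outside h-outside (transforms (FiniteField.ring F))))
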